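{- Let $\ell,\beta$ be positive integers. Define rational numbers $c_{\ell-1},c_{\ell-2},\ldots,c_0$ recursively (in this order) by $$c_k=k!\,(\beta^{\ell-k}-1)\sum_{i=k}^\ell\frac{S_1(i,k)}{i!}-\sum_{i=k+2}^\ell\sum_{j=k+1}^i\frac{S_1(i,j)\,j!}{i!\,(j-k)!}\,c_{i-1}^{\,j-k}.$$ Then, as an identity of polynomials in $q$, $$\beta^\ell\left(\binom{q+\ell-1}{\ell}+\binom{q+\ell-2}{\ell-1}+\cdots+\binom{q}{1}\right)=\binom{\beta q+c_{\ell-1}+\ell-1}{\ell}+\binom{\beta q+c_{\ell-2}+\ell-2}{\ell-1}+\cdots+\binom{\beta q+c_0}{1}.$$ Moreover, if all $c_k$ ($0\le k<\ell$) are integers and $c_{\ell-1}\ge c_{\ell-2}\ge\cdots\ge c_0$, then for all integers $q\ge -c_0/\beta$, $$\mathrm{rep}_\ell(\beta^\ell\,\mathrm{val}_\ell(a_\ell^q))=a_1^{c_{\ell-1}-c_{\ell-2}}a_2^{c_{\ell-2}-c_{\ell-3}}\cdots a_{\ell-1}^{c_1-c_0}a_\ell^{\beta q+c_0},$$ and hence the language $\{\mathrm{rep}_\ell(\beta^\ell\,\mathrm{val}_\ell(a_\ell^q)):q\ge0\}$ is regular.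
   Context: The unsigned Stirling numbers of the first kind $S_1(i,j)$ ($i,j\ge0$) are defined by $x(x+1)\cdots(x+i-1)=\sum_{j=1}^iS_1(i,j)x^j$, with the convention $S_1(i,j)=0$ if $i<j$ or $j=0$ (in particular $S_1(0,0)=0$). Here $\binom{x}{m}=x(x-1)\cdots(x-m+1)/m!$ is regarded as a polynomial in $x$. Let $\Sigma_\ell=\{a_1<\cdots<a_\ell\}$ and $\mathcal{B}_\ell=a_1^*\cdots a_\ell^*$; $\mathrm{rep}_\ell(n)$ is the $(n+1)$-st word of $\mathcal{B}_\ell$ in genealogical order (shorter words first; equal-length words ordered lexicographically), and $\mathrm{val}_\ell=\mathrm{rep}_\ell^{ -1}$. -}

module Defs where

open import Data.Bool using (Bool; true; false; if_then_else_; _∧_)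
open import Data.Nat as ℕ using (ℕ; zero; suc; _∸_; _<ᵇ_; _≤ᵇ_; _≡ᵇ_)
open import Data.Integer as ℤ using (ℤ)
open import Data.Rational as ℚ using (ℚ; 0ℚ; 1ℚ)
open import Data.Fin as Fin using (Fin; toℕ)
open import Data.List using (List; []; _∷_; map; foldr; concatMap; upTo; allFin; filterᵇ; length; replicate; foldl)
open import Data.Maybe using (Maybe; just; nothing)
open import Data.Product using (Σ; _×_)
open import Relation.Binary.PropositionalEquality using (_≡_)
import Data.Nat.Properties as ℕP

-- Unsigned Stirling numbers of the first kind.
-- S1std is the standard table (S1std 0 0 = 1); the paper's convention
-- S1(i,0) = 0 for all i (including S1(0,0) = 0) is imposed in S1.

S1std : ℕ → ℕ → ℕ
S1std zero    zero    = 1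
S1std zero    (suc k) = 0
S1std (suc n) zero    = 0
S1std (suc n) (suc k) = n ℕ.* S1std n (suc k) ℕ.+ S1std n k

S1 : ℕ → ℕ → ℕ
S1 i zero    = 0
S1 i (suc j) = S1std i (suc j)

ℕtoℚ : ℕ → ℚ
ℕtoℚ n = ℤ.+ n ℚ./ 1

ℤtoℚ : ℤ → ℚ
ℤtoℚ z = z ℚ./ 1

powQ : ℚ → ℕ → ℚ
powQ x zero    = 1ℚ
powQ x (suc n) = x ℚ.* powQ x n

sumQ : List ℚ → ℚ
sumQ = foldr ℚ._+_ 0ℚ

-- [a, a+1, ..., b]  (empty if b < a)
range : ℕ → ℕ → List ℕ
range a b = map (a ℕ.+_) (upTo (suc b ∸ a))

Σ[_to_] : ℕ → ℕ → (ℕ → ℚ) → ℚ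
Σ[ a to b ] f = sumQ (map f (range a b))

invFact : ℕ → ℚ
invFact m = ℤ.+ 1 ℚ./ (m ℕ.!)
  where instance _ = m ℕP.!≢0

-- The numbers c_k (k = ℓ-1, ℓ-2, ..., 0), defined recursively.
-- cFormula ℓ β g k is the right-hand side of the defining equation of
-- c_k, where g stands for the (already defined) values c_{k+1},...,c_{ℓ-1}:
--   c_k = k! (β^{ℓ-k} - 1) Σ_{i=k}^{ℓ} S1(i,k)/i!
--         - Σ_{i=k+2}^{ℓ} Σ_{j=k+1}^{i} S1(i,j) j! / (i! (j-k)!) · c_{i-1}^{j-k}

cFormula : ℕ → ℕ → (ℕ → ℚ) → ℕ → ℚ
cFormula ℓ β g k =
  (ℕtoℚ (k ℕ.!) ℚ.* (powQ (ℕtoℚ β) (ℓ ∸ k) ℚ.- 1ℚ)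
     ℚ.* Σ[ k to ℓ ] (λ i → ℕtoℚ (S1 i k) ℚ.* invFact i))
  ℚ.- Σ[ suc (suc k) to ℓ ] (λ i → Σ[ suc k to i ] (λ j →
        ℕtoℚ (S1 i j ℕ.* (j ℕ.!)) ℚ.* invFact i ℚ.* invFact (j ∸ k)
          ℚ.* powQ (g (i ∸ 1)) (j ∸ k)))

-- cTab ℓ β n j = c_j for ℓ-n ≤ j ≤ ℓ-1 (when n ≤ ℓ); it adds c_{ℓ-(n+1)}
-- at step n+1, computed from the previously defined values.
cTab : ℕ → ℕ → ℕ → ℕ → ℚ
cTab ℓ β zero    j = 0ℚ
cTab ℓ β (suc n) j =
  if j ≡ᵇ (ℓ ∸ suc n) then cFormula ℓ β (cTab ℓ β n) j else cTab ℓ β n j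

-- c ℓ β k = c_k  (meaningful for 0 ≤ k < ℓ)
c : ℕ → ℕ → ℕ → ℚ
c ℓ β k = cTab ℓ β ℓ k

binomQ : ℚ → ℕ → ℚ
binomQ x zero    = 1ℚ
binomQ x (suc m) = binomQ x m ℚ.* (x ℚ.- ℕtoℚ m) ℚ.* (ℤ.+ 1 ℚ./ suc m)

-- Words over Σ_ℓ = {a_1 < ... < a_ℓ}; letter a_{t+1} is (t : Fin ℓ).

Word : ℕ → Set
Word ℓ = List (Fin ℓ)

-- membership in B_ℓ = a_1^* ... a_ℓ^*  (letters non-decreasing)
inBᵇ : ∀ {ℓ} → Word ℓ → Bool
inBᵇ []            = true
inBᵇ (x ∷ [])      = true
inBᵇ (x ∷ y ∷ w)   = (toℕ x ≤ᵇ toℕ y) ∧ inBᵇ (y ∷ w)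

allWords : (ℓ m : ℕ) → List (Word ℓ)
allWords ℓ zero    = [] ∷ []
allWords ℓ (suc m) = concatMap (λ x → map (x ∷_) (allWords ℓ m)) (allFin ℓ)

wordsB : (ℓ m : ℕ) → List (Word ℓ)
wordsB ℓ m = filterᵇ inBᵇ (allWords ℓ m)

nth : ∀ {A : Set} → List A → ℕ → Maybe A
nth []       n       = nothing
nth (x ∷ xs) zero    = just x
nth (x ∷ xs) (suc n) = nth xs n

repAux : (ℓ : ℕ) → ℕ → ℕ → ℕ → Maybe (Word ℓ)
repAux ℓ zero       m n = nothing
repAux ℓ (suc fuel) m n =
  if n <ᵇ length (wordsB ℓ m)
  then nth (wordsB ℓ m) n
  else repAux ℓ fuel (suc m) (n ∸ length (wordsB ℓ m))

-- rep_ℓ(n) = the (n+1)-st word of B_ℓ in genealogical order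
-- (fuel n+1 suffices for ℓ ≥ 1 since each length contributes ≥ 1 word).
rep : (ℓ : ℕ) → ℕ → Maybe (Word ℓ)
rep ℓ n = repAux ℓ (suc n) 0 n

aTop : (ℓ : ℕ) → 1 ℕ.≤ ℓ → Fin ℓ
aTop (suc m) _ = Fin.fromℕ m

-- a_1^{e 0} a_2^{e 1} ... a_ℓ^{e (ℓ-1)}
powWord : (ℓ : ℕ) → (Fin ℓ → ℕ) → Word ℓ
powWord ℓ e = concatMap (λ t → replicate (e t) t) (allFin ℓ)

-- exponents of a_1^{c_{ℓ-1}-c_{ℓ-2}} ... a_{ℓ-1}^{c_1-c_0} a_ℓ^{βq+c_0},
-- given integer values d k = c_k
targetExp : (ℓ β : ℕ) → (ℕ → ℤ) → ℕ → Fin ℓ → ℕ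
targetExp ℓ β d q t =
  if suc (toℕ t) <ᵇ ℓ
  then ℤ.∣ d (ℓ ∸ suc (toℕ t)) ℤ.- d (ℓ ∸ suc (suc (toℕ t))) ∣
  else ℤ.∣ ℤ.+ (β ℕ.* q) ℤ.+ d 0 ∣

record DFA (ℓ : ℕ) : Set where
  field
    states : ℕ
    start  : Fin states
    δ      : Fin states → Fin ℓ → Fin states
    accept : Fin states → Bool

accepts : ∀ {ℓ} → DFA ℓ → Word ℓ → Bool
accepts A w = DFA.accept A (foldl (DFA.δ A) (DFA.start A) w)

Regular : (ℓ : ℕ) → (Word ℓ → Set) → Set
Regular ℓ L = Σ (DFA ℓ) λ A → (w : Word ℓ) →
  ((accepts A w ≡ true → L w) × (L w → accepts A w ≡ true))

module Submission where

-- (1) PolynomialIdentity: expanding binom(y+k, k+1) = (1/(k+1)!) Σ_j S1(k+1,j) y^j and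
--     (βq + c_k)^j by the binomial theorem, both sides become polynomials in q, and the
--     recursion defining c_m says exactly that their coefficients of q^m agree.  For a_ℓ^q all n_k = q; for the target word n_k = βq + c_k (TargetWords).
--     So (1) at the point q gives β^ℓ val_ℓ(a_ℓ^q) = val_ℓ(target word).
-- (3) Automata: for q ≥ q₀ = |c_0| the images are target(q₀) a_ℓ^{β(q-q₀)}, accepted by a
--     lasso automaton; the finitely many smaller q contribute a finite language.

open import Defs
open import Data.Nat as ℕ using (ℕ; suc; _∸_)
open import Data.Integer as ℤ using (ℤ)
open import Data.Rational as ℚ using (ℚ)
open import Data.List using (List; replicate)
open import Data.Maybe using (just)
open import Data.Product using (Σ; _×_)
open import Relation.Binary.PropositionalEquality using (_≡_)

module Booleans where

  open import Data.Bool using (true; false; T; _∧_)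
  open import Data.Nat as ℕ using (ℕ; _≡ᵇ_; _<ᵇ_; _≤ᵇ_)
  import Data.Nat.Properties as ℕP
  open import Relation.Nullary using (¬_)
  open import Data.Empty using (⊥-elim)
  open import Relation.Binary.PropositionalEquality

  T⇒true : ∀ {b} → T b → b ≡ true
  T⇒true {true} _ = refl

  ¬T⇒false : ∀ {b} → ¬ T b → b ≡ false
  ¬T⇒false {false} _ = refl
  ¬T⇒false {true}  t = ⊥-elim (t _)

  true⇒T : ∀ {b} → b ≡ true → T b
  true⇒T refl = _

  ≡ᵇ-refl : ∀ a → (a ≡ᵇ a) ≡ true
  ≡ᵇ-refl a = T⇒true (ℕP.≡⇒≡ᵇ a a refl)

  ≡ᵇ-≢ : ∀ {a b} → a ≢ b → (a ≡ᵇ b) ≡ false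
  ≡ᵇ-≢ {a} {b} a≢b = ¬T⇒false (λ t → a≢b (ℕP.≡ᵇ⇒≡ a b t))

  ≡ᵇ⇒≡ : ∀ {a b} → (a ≡ᵇ b) ≡ true → a ≡ b
  ≡ᵇ⇒≡ {a} {b} e = ℕP.≡ᵇ⇒≡ a b (true⇒T e)

  <ᵇ-true : ∀ {m n} → m ℕ.< n → (m <ᵇ n) ≡ true
  <ᵇ-true p = T⇒true (ℕP.<⇒<ᵇ p)

  <ᵇ-false : ∀ {m n} → n ℕ.≤ m → (m <ᵇ n) ≡ false
  <ᵇ-false {m} {n} p = ¬T⇒false (λ t → ℕP.<⇒≱ (ℕP.<ᵇ⇒< m n t) p)

  <ᵇ⇒< : ∀ {m n} → (m <ᵇ n) ≡ true → m ℕ.< n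
  <ᵇ⇒< {m} {n} e = ℕP.<ᵇ⇒< m n (true⇒T e)

  ≤ᵇ-true : ∀ {m n} → m ℕ.≤ n → (m ≤ᵇ n) ≡ true
  ≤ᵇ-true p = T⇒true (ℕP.≤⇒≤ᵇ p)

  ≤ᵇ-false : ∀ {m n} → n ℕ.< m → (m ≤ᵇ n) ≡ false
  ≤ᵇ-false {m} {n} p = ¬T⇒false (λ t → ℕP.<⇒≱ p (ℕP.≤ᵇ⇒≤ m n t))

  ≤ᵇ⇒≤ : ∀ {m n} → (m ≤ᵇ n) ≡ true → m ℕ.≤ n
  ≤ᵇ⇒≤ {m} {n} e = ℕP.≤ᵇ⇒≤ m n (true⇒T e)

  ∧-true-l : ∀ {a b} → (a ∧ b) ≡ true → a ≡ true
  ∧-true-l {true} _ = refl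

  ∧-true-r : ∀ {a b} → (a ∧ b) ≡ true → b ≡ true
  ∧-true-r {true} e = e

module Rationals where

  open import Defs
  open import Data.Nat as ℕ using (ℕ; zero; suc)
  import Data.Nat.Properties as ℕP
  open import Data.Integer as ℤ using (ℤ; -[1+_])
  import Data.Integer.Properties as ℤP
  open import Data.Rational as ℚ using (ℚ; 1ℚ; _+_; _*_; -_)
  import Data.Rational.Properties as ℚP
  open import Data.Rational.Unnormalised as ℚᵘ using (mkℚᵘ; *≡*)
  import Data.Rational.Unnormalised.Properties as ℚᵘP
  import Data.Nat.Coprimality as Coprime
  open import Relation.Binary.PropositionalEquality
  open import Data.Rational.Solver using (module +-*-Solver)
  open +-*-Solver

  ℤtoℚ-toℚᵘ : ∀ z → ℚ.toℚᵘ (ℤtoℚ z) ≡ mkℚᵘ z 0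
  ℤtoℚ-toℚᵘ (ℤ.+ n)  = cong ℚ.toℚᵘ (ℚP.normalize-coprime {n} {0} (Coprime.sym (Coprime.1-coprimeTo n)))
  ℤtoℚ-toℚᵘ -[1+ n ] =
    cong (λ x → ℚ.toℚᵘ (- x)) (ℚP.normalize-coprime {suc n} {0} (Coprime.sym (Coprime.1-coprimeTo (suc n))))

  ℤtoℚ-+ : ∀ a b → ℤtoℚ (a ℤ.+ b) ≡ ℤtoℚ a + ℤtoℚ b
  ℤtoℚ-+ a b = ℚP.toℚᵘ-injective (begin
    ℚ.toℚᵘ (ℤtoℚ (a ℤ.+ b))            ≈⟨ ℚᵘP.≃-reflexive (ℤtoℚ-toℚᵘ (a ℤ.+ b)) ⟩
    mkℚᵘ (a ℤ.+ b) 0                   ≈⟨ *≡* (cong (ℤ._* ℤ.+ 1) (cong₂ ℤ._+_ (sym (ℤP.*-identityʳ a)) (sym (ℤP.*-identityʳ b)))) ⟩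
    mkℚᵘ a 0 ℚᵘ.+ mkℚᵘ b 0             ≈⟨ ℚᵘP.≃-sym (ℚᵘP.≃-reflexive (cong₂ ℚᵘ._+_ (ℤtoℚ-toℚᵘ a) (ℤtoℚ-toℚᵘ b))) ⟩
    ℚ.toℚᵘ (ℤtoℚ a) ℚᵘ.+ ℚ.toℚᵘ (ℤtoℚ b) ≈⟨ ℚᵘP.≃-sym (ℚP.toℚᵘ-homo-+ (ℤtoℚ a) (ℤtoℚ b)) ⟩
    ℚ.toℚᵘ (ℤtoℚ a + ℤtoℚ b)           ∎)
    where open ℚᵘP.≃-Reasoning

  ℤtoℚ-* : ∀ a b → ℤtoℚ (a ℤ.* b) ≡ ℤtoℚ a * ℤtoℚ b
  ℤtoℚ-* a b = ℚP.toℚᵘ-injective (begin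
    ℚ.toℚᵘ (ℤtoℚ (a ℤ.* b))            ≈⟨ ℚᵘP.≃-reflexive (ℤtoℚ-toℚᵘ (a ℤ.* b)) ⟩
    mkℚᵘ a 0 ℚᵘ.* mkℚᵘ b 0             ≈⟨ ℚᵘP.≃-sym (ℚᵘP.≃-reflexive (cong₂ ℚᵘ._*_ (ℤtoℚ-toℚᵘ a) (ℤtoℚ-toℚᵘ b))) ⟩
    ℚ.toℚᵘ (ℤtoℚ a) ℚᵘ.* ℚ.toℚᵘ (ℤtoℚ b) ≈⟨ ℚᵘP.≃-sym (ℚP.toℚᵘ-homo-* (ℤtoℚ a) (ℤtoℚ b)) ⟩
    ℚ.toℚᵘ (ℤtoℚ a * ℤtoℚ b)           ∎)
    where open ℚᵘP.≃-Reasoning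

  ℤtoℚ-injective : ∀ a b → ℤtoℚ a ≡ ℤtoℚ b → a ≡ b
  ℤtoℚ-injective a b e = cong ℚᵘ.↥_ (trans (sym (ℤtoℚ-toℚᵘ a)) (trans (cong ℚ.toℚᵘ e) (ℤtoℚ-toℚᵘ b)))

  ℕtoℚ-+ : ∀ a b → ℕtoℚ (a ℕ.+ b) ≡ ℕtoℚ a + ℕtoℚ b
  ℕtoℚ-+ a b = ℤtoℚ-+ (ℤ.+ a) (ℤ.+ b)

  ℕtoℚ-* : ∀ a b → ℕtoℚ (a ℕ.* b) ≡ ℕtoℚ a * ℕtoℚ b
  ℕtoℚ-* a b = trans (cong ℤtoℚ (ℤP.pos-* a b)) (ℤtoℚ-* (ℤ.+ a) (ℤ.+ b))

  ℕtoℚ-suc : ∀ n → ℕtoℚ (suc n) ≡ 1ℚ + ℕtoℚ n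
  ℕtoℚ-suc n = ℕtoℚ-+ 1 n

  ℕtoℚ-^ : ∀ b n → ℕtoℚ (b ℕ.^ n) ≡ powQ (ℕtoℚ b) n
  ℕtoℚ-^ b zero    = refl
  ℕtoℚ-^ b (suc n) = trans (ℕtoℚ-* b (b ℕ.^ n)) (cong (ℕtoℚ b *_) (ℕtoℚ-^ b n))

  ℕtoℚ-injective : ∀ a b → ℕtoℚ a ≡ ℕtoℚ b → a ≡ b
  ℕtoℚ-injective a b e = ℤP.+-injective (ℤtoℚ-injective (ℤ.+ a) (ℤ.+ b) e)

  inv : (n : ℕ) → .{{_ : ℕ.NonZero n}} → ℚ
  inv n = ℤ.+ 1 ℚ./ n

  inv-* : ∀ n .{{_ : ℕ.NonZero n}} → inv n * ℕtoℚ n ≡ 1ℚ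
  inv-* (suc m) = ℚP.toℚᵘ-injective (begin
    ℚ.toℚᵘ (inv (suc m) * ℕtoℚ (suc m))            ≈⟨ ℚP.toℚᵘ-homo-* (inv (suc m)) (ℕtoℚ (suc m)) ⟩
    ℚ.toℚᵘ (inv (suc m)) ℚᵘ.* ℚ.toℚᵘ (ℕtoℚ (suc m)) ≈⟨ ℚᵘP.≃-reflexive (cong₂ ℚᵘ._*_ inv-toℚᵘ (ℤtoℚ-toℚᵘ (ℤ.+ suc m))) ⟩
    mkℚᵘ (ℤ.+ 1) m ℚᵘ.* mkℚᵘ (ℤ.+ suc m) 0          ≈⟨ *≡* cross ⟩
    ℚᵘ.1ℚᵘ                                         ∎)
    where
    open ℚᵘP.≃-Reasoning
    inv-toℚᵘ : ℚ.toℚᵘ (inv (suc m)) ≡ mkℚᵘ (ℤ.+ 1) m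
    inv-toℚᵘ = cong ℚ.toℚᵘ (ℚP.normalize-coprime {1} {m} (Coprime.1-coprimeTo (suc m)))
    cross : (ℤ.+ 1 ℤ.* ℤ.+ suc m) ℤ.* ℤ.+ 1 ≡ ℤ.+ 1 ℤ.* ℤ.+ (suc m ℕ.* 1)
    cross = trans (ℤP.*-identityʳ _) (trans (ℤP.*-identityˡ (ℤ.+ suc m))
              (sym (trans (ℤP.*-identityˡ _) (cong ℤ.+_ (ℕP.*-identityʳ (suc m))))))

  inv-unique : ∀ n .{{_ : ℕ.NonZero n}} x → x * ℕtoℚ n ≡ 1ℚ → x ≡ inv n
  inv-unique n x e = begin
    x                        ≡⟨ solve 1 (λ x → x := x :* con 1ℚ) refl x ⟩
    x * 1ℚ                   ≡⟨ cong (x *_) (sym (trans (ℚP.*-comm (ℕtoℚ n) (inv n)) (inv-* n))) ⟩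
    x * (ℕtoℚ n * inv n)     ≡⟨ sym (ℚP.*-assoc x (ℕtoℚ n) (inv n)) ⟩
    (x * ℕtoℚ n) * inv n     ≡⟨ cong (_* inv n) e ⟩
    1ℚ * inv n               ≡⟨ ℚP.*-identityˡ (inv n) ⟩
    inv n                    ∎
    where open ≡-Reasoning

  invFact-* : ∀ m → invFact m * ℕtoℚ (m ℕ.!) ≡ 1ℚ
  invFact-* m = inv-* (m ℕ.!) {{ℕP._!≢0 m}}

  invFact-suc : ∀ m → invFact (suc m) ≡ invFact m * inv (suc m)
  invFact-suc m = sym (inv-unique (suc m ℕ.!) {{ℕP._!≢0 (suc m)}} _ (begin
    invFact m * inv (suc m) * ℕtoℚ (suc m ℕ.* m ℕ.!)
      ≡⟨ cong (invFact m * inv (suc m) *_) (ℕtoℚ-* (suc m) (m ℕ.!)) ⟩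
    invFact m * inv (suc m) * (ℕtoℚ (suc m) * ℕtoℚ (m ℕ.!))
      ≡⟨ solve 4 (λ a b c d → a :* b :* (c :* d) := (a :* d) :* (b :* c)) refl
           (invFact m) (inv (suc m)) (ℕtoℚ (suc m)) (ℕtoℚ (m ℕ.!)) ⟩
    (invFact m * ℕtoℚ (m ℕ.!)) * (inv (suc m) * ℕtoℚ (suc m))
      ≡⟨ cong₂ _*_ (invFact-* m) (inv-* (suc m)) ⟩
    1ℚ ∎))
    where open ≡-Reasoning

module FiniteSums where

  open import Defs
  open import Algebra.Core using (Op₂)
  open import Algebra.Structures using (IsCommutativeMonoid)
  open import Data.Nat as ℕ using (ℕ; zero; suc; _∸_; z≤n; s≤s)
  import Data.Nat.Properties as ℕP
  open import Data.Rational using (ℚ; _+_; _*_)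
  import Data.Rational.Properties as ℚP
  open import Data.List using (map; applyUpTo)
  open import Function using (_∘_; id)
  open import Relation.Binary.PropositionalEquality
  open Rationals using (ℕtoℚ-+)

  module FinSum {A : Set} {_∙_ : Op₂ A} {ε : A} (isCM : IsCommutativeMonoid _≡_ _∙_ ε) where
    open IsCommutativeMonoid isCM using (assoc; comm; identityˡ; identityʳ)

    sumN : ℕ → (ℕ → A) → A
    sumN zero    f = ε
    sumN (suc n) f = f 0 ∙ sumN n (f ∘ suc)

    sumN-cong : ∀ n {f g : ℕ → A} → (∀ i → i ℕ.< n → f i ≡ g i) → sumN n f ≡ sumN n g
    sumN-cong zero    e = refl
    sumN-cong (suc n) e = cong₂ _∙_ (e 0 (s≤s z≤n)) (sumN-cong n (λ i p → e (suc i) (s≤s p)))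

    sumN-0 : ∀ n {f : ℕ → A} → (∀ i → i ℕ.< n → f i ≡ ε) → sumN n f ≡ ε
    sumN-0 zero    e = refl
    sumN-0 (suc n) e = trans (cong₂ _∙_ (e 0 (s≤s z≤n)) (sumN-0 n (λ i p → e (suc i) (s≤s p)))) (identityˡ ε)

    sumN-∙ : ∀ n (f g : ℕ → A) → sumN n (λ i → f i ∙ g i) ≡ sumN n f ∙ sumN n g
    sumN-∙ zero    f g = sym (identityˡ ε)
    sumN-∙ (suc n) f g = begin
      (f 0 ∙ g 0) ∙ sumN n (λ i → f (suc i) ∙ g (suc i))  ≡⟨ cong ((f 0 ∙ g 0) ∙_) (sumN-∙ n (f ∘ suc) (g ∘ suc)) ⟩
      (f 0 ∙ g 0) ∙ (F ∙ G)                              ≡⟨ assoc (f 0) (g 0) (F ∙ G) ⟩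
      f 0 ∙ (g 0 ∙ (F ∙ G))                              ≡⟨ cong (f 0 ∙_) (sym (assoc (g 0) F G)) ⟩
      f 0 ∙ ((g 0 ∙ F) ∙ G)                              ≡⟨ cong (λ z → f 0 ∙ (z ∙ G)) (comm (g 0) F) ⟩
      f 0 ∙ ((F ∙ g 0) ∙ G)                              ≡⟨ cong (f 0 ∙_) (assoc F (g 0) G) ⟩
      f 0 ∙ (F ∙ (g 0 ∙ G))                              ≡⟨ sym (assoc (f 0) F (g 0 ∙ G)) ⟩
      (f 0 ∙ F) ∙ (g 0 ∙ G)                              ∎
      where
      open ≡-Reasoning
      F = sumN n (f ∘ suc)
      G = sumN n (g ∘ suc)

    sumN-split : ∀ a b (f : ℕ → A) → sumN (a ℕ.+ b) f ≡ sumN a f ∙ sumN b (λ i → f (a ℕ.+ i))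
    sumN-split zero    b f = sym (identityˡ _)
    sumN-split (suc a) b f = trans (cong (f 0 ∙_) (sumN-split a b (f ∘ suc))) (sym (assoc (f 0) _ _))

    sumN-last : ∀ n (f : ℕ → A) → sumN (suc n) f ≡ sumN n f ∙ f n
    sumN-last n f = begin
      sumN (suc n) f                          ≡⟨ cong (λ k → sumN k f) (ℕP.+-comm 1 n) ⟩
      sumN (n ℕ.+ 1) f                        ≡⟨ sumN-split n 1 f ⟩
      sumN n f ∙ (f (n ℕ.+ 0) ∙ ε)            ≡⟨ cong (sumN n f ∙_) (trans (identityʳ _) (cong f (ℕP.+-identityʳ n))) ⟩
      sumN n f ∙ f n                          ∎
      where open ≡-Reasoning

    sumN-swap : ∀ n m (f : ℕ → ℕ → A) →
      sumN n (λ i → sumN m (f i)) ≡ sumN m (λ j → sumN n (λ i → f i j))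
    sumN-swap zero    m f = sym (sumN-0 m (λ _ _ → refl))
    sumN-swap (suc n) m f = trans (cong (sumN m (f 0) ∙_) (sumN-swap n m (f ∘ suc)))
      (sym (sumN-∙ m (f 0) (λ j → sumN n (λ i → f (suc i) j))))

    sumN-vanish : ∀ a N (f : ℕ → A) → a ℕ.≤ N → (∀ i → a ℕ.≤ i → i ℕ.< N → f i ≡ ε) → sumN N f ≡ sumN a f
    sumN-vanish zero    N       f _         e = sumN-0 N (λ i p → e i z≤n p)
    sumN-vanish (suc a) (suc N) f (s≤s a≤N) e =
      cong (f 0 ∙_) (sumN-vanish a N (f ∘ suc) a≤N (λ i p q → e (suc i) (s≤s p) (s≤s q)))

    sumN-single : ∀ n p (f : ℕ → A) → p ℕ.< n → (∀ i → i ℕ.< n → i ≢ p → f i ≡ ε) → sumN n f ≡ f p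
    sumN-single (suc n) zero    f _ e =
      trans (cong (f 0 ∙_) (sumN-0 n (λ i q → e (suc i) (s≤s q) (λ ())))) (identityʳ _)
    sumN-single (suc n) (suc p) f (s≤s p<n) e =
      trans (cong₂ _∙_ (e 0 (s≤s z≤n) (λ ()))
                       (sumN-single n p (f ∘ suc) p<n (λ i q ne → e (suc i) (s≤s q) (ne ∘ ℕP.suc-injective))))
            (identityˡ _)

    sumN-peel : ∀ a N (f : ℕ → A) → a ℕ.< N →
      sumN N f ≡ sumN a f ∙ (f a ∙ sumN (N ∸ suc a) (λ u → f (suc (a ℕ.+ u))))
    sumN-peel a N f a<N = begin
      sumN N f                                            ≡⟨ cong (λ z → sumN z f) (sym N≡a+1+r) ⟩
      sumN (a ℕ.+ suc r) f                                ≡⟨ sumN-split a (suc r) f ⟩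
      sumN a f ∙ (f (a ℕ.+ 0) ∙ sumN r (λ u → f (a ℕ.+ suc u)))
        ≡⟨ cong₂ (λ x y → sumN a f ∙ (f x ∙ y)) (ℕP.+-identityʳ a) (sumN-cong r (λ u _ → cong f (ℕP.+-suc a u))) ⟩
      sumN a f ∙ (f a ∙ sumN r (λ u → f (suc (a ℕ.+ u)))) ∎
      where
      open ≡-Reasoning
      r = N ∸ suc a
      N≡a+1+r : a ℕ.+ suc r ≡ N
      N≡a+1+r = trans (ℕP.+-suc a r) (ℕP.m+[n∸m]≡n a<N)

    sumN-reverse : ∀ n f → sumN n f ≡ sumN n (λ k → f (n ∸ suc k))
    sumN-reverse zero    f = refl
    sumN-reverse (suc n) f = begin
      f 0 ∙ sumN n (f ∘ suc)                         ≡⟨ cong (f 0 ∙_) (sumN-reverse n (f ∘ suc)) ⟩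
      f 0 ∙ sumN n (λ k → f (suc (n ∸ suc k)))       ≡⟨ comm (f 0) _ ⟩
      sumN n (λ k → f (suc (n ∸ suc k))) ∙ f 0
        ≡⟨ cong₂ _∙_ (sumN-cong n (λ k p → cong f (sym (ℕP.+-∸-assoc 1 p)))) (cong f (sym (ℕP.n∸n≡0 n))) ⟩
      sumN n (λ k → f (n ∸ k)) ∙ f (n ∸ n)           ≡⟨ sym (sumN-last n (λ k → f (n ∸ k))) ⟩
      sumN (suc n) (λ k → f (suc n ∸ suc k))         ∎
      where open ≡-Reasoning

  module ℕΣ = FinSum ℕP.+-0-isCommutativeMonoid
  module ℚΣ = FinSum ℚP.+-0-isCommutativeMonoid

  open ℚΣ

  sumN-*ˡ : ∀ n a (f : ℕ → ℚ) → a * sumN n f ≡ sumN n (λ i → a * f i)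
  sumN-*ˡ zero    a f = ℚP.*-zeroʳ a
  sumN-*ˡ (suc n) a f = trans (ℚP.*-distribˡ-+ a (f 0) _) (cong (a * f 0 +_) (sumN-*ˡ n a (f ∘ suc)))

  sumN-*ʳ : ∀ n a (f : ℕ → ℚ) → sumN n f * a ≡ sumN n (λ i → f i * a)
  sumN-*ʳ n a f =
    trans (ℚP.*-comm _ a) (trans (sumN-*ˡ n a f) (sumN-cong n (λ i _ → ℚP.*-comm a (f i))))

  ℕtoℚ-sumN : ∀ n f → ℕtoℚ (ℕΣ.sumN n f) ≡ sumN n (λ i → ℕtoℚ (f i))
  ℕtoℚ-sumN zero    f = refl
  ℕtoℚ-sumN (suc n) f = trans (ℕtoℚ-+ (f 0) _) (cong (ℕtoℚ (f 0) +_) (ℕtoℚ-sumN n (f ∘ suc)))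

  Σ-to : ∀ a b f → Σ[ a to b ] f ≡ sumN (suc b ∸ a) (λ i → f (a ℕ.+ i))
  Σ-to a b f = go id (suc b ∸ a)
    where
    go : ∀ (h : ℕ → ℕ) n → sumQ (map f (map (a ℕ.+_) (applyUpTo h n))) ≡ sumN n (λ i → f (a ℕ.+ h i))
    go h zero    = refl
    go h (suc n) = cong (f (a ℕ.+ h 0) +_) (go (h ∘ suc) n)

module Polynomials where

  open import Defs
  open import Data.Nat as ℕ using (ℕ; zero; suc; _∸_; s≤s)
  import Data.Nat.Properties as ℕP
  open import Data.Nat.Combinatorics using (_C_; k>n⇒nCk≡0; nCk+nC[k+1]≡[n+1]C[k+1]; nCk≡n!/k![n-k]!; k![n∸k]!∣n!)
  open import Data.Nat.DivMod using (m/n*n≡m)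
  open import Data.Rational using (ℚ; 0ℚ; 1ℚ; _+_; _*_; _-_)
  import Data.Rational.Properties as ℚP
  open import Function using (_∘_)
  open import Relation.Binary.PropositionalEquality
  open import Data.Rational.Solver using (module +-*-Solver)
  open +-*-Solver
  open Rationals
  open FiniteSums
  open ℚΣ

  pow-* : ∀ x y m → powQ (x * y) m ≡ powQ x m * powQ y m
  pow-* x y zero    = refl
  pow-* x y (suc m) = trans (cong ((x * y) *_) (pow-* x y m))
    (solve 4 (λ x y a b → x :* y :* (a :* b) := x :* a :* (y :* b)) refl x y (powQ x m) (powQ y m))

  pow-+ : ∀ x a b → powQ x (a ℕ.+ b) ≡ powQ x a * powQ x b
  pow-+ x zero    b = sym (ℚP.*-identityˡ (powQ x b))
  pow-+ x (suc a) b = trans (cong (x *_) (pow-+ x a b)) (sym (ℚP.*-assoc x (powQ x a) (powQ x b)))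

  fall : ℚ → ℕ → ℚ
  fall x zero    = 1ℚ
  fall x (suc m) = fall x m * (x - ℕtoℚ m)

  rise : ℚ → ℕ → ℚ
  rise y zero    = 1ℚ
  rise y (suc n) = rise y n * (y + ℕtoℚ n)

  binom-fall : ∀ x m → binomQ x m ≡ fall x m * invFact m
  binom-fall x zero    = refl
  binom-fall x (suc m) = begin
    binomQ x m * (x - ℕtoℚ m) * inv (suc m)
      ≡⟨ cong (λ z → z * (x - ℕtoℚ m) * inv (suc m)) (binom-fall x m) ⟩
    fall x m * invFact m * (x - ℕtoℚ m) * inv (suc m)
      ≡⟨ solve 4 (λ a b c d → a :* b :* c :* d := a :* c :* (b :* d)) refl
           (fall x m) (invFact m) (x - ℕtoℚ m) (inv (suc m)) ⟩
    fall x m * (x - ℕtoℚ m) * (invFact m * inv (suc m))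
      ≡⟨ cong (fall x m * (x - ℕtoℚ m) *_) (sym (invFact-suc m)) ⟩
    fall x m * (x - ℕtoℚ m) * invFact (suc m) ∎
    where open ≡-Reasoning

  fall-shift : ∀ x j → fall (x + 1ℚ) (suc j) ≡ (x + 1ℚ) * fall x j
  fall-shift x zero    = solve 1 (λ x → con 1ℚ :* ((x :+ con 1ℚ) :- con 0ℚ) := (x :+ con 1ℚ) :* con 1ℚ) refl x
  fall-shift x (suc j) = begin
    fall (x + 1ℚ) (suc j) * (x + 1ℚ - ℕtoℚ (suc j))
      ≡⟨ cong₂ (λ a b → a * (x + 1ℚ - b)) (fall-shift x j) (ℕtoℚ-suc j) ⟩
    (x + 1ℚ) * fall x j * (x + 1ℚ - (1ℚ + ℕtoℚ j))
      ≡⟨ solve 3 (λ x f n → (x :+ con 1ℚ) :* f :* (x :+ con 1ℚ :- (con 1ℚ :+ n)) := (x :+ con 1ℚ) :* (f :* (x :- n)))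
           refl x (fall x j) (ℕtoℚ j) ⟩
    (x + 1ℚ) * (fall x j * (x - ℕtoℚ j)) ∎
    where open ≡-Reasoning

  fall-rise : ∀ y k → fall (y + ℕtoℚ k) (suc k) ≡ rise y (suc k)
  fall-rise y zero    = solve 1 (λ y → con 1ℚ :* (y :+ con 0ℚ :- con 0ℚ) := con 1ℚ :* (y :+ con 0ℚ)) refl y
  fall-rise y (suc k) = begin
    fall (y + ℕtoℚ (suc k)) (suc (suc k))        ≡⟨ cong (λ z → fall z (suc (suc k))) shift ⟩
    fall (y + ℕtoℚ k + 1ℚ) (suc (suc k))         ≡⟨ fall-shift (y + ℕtoℚ k) (suc k) ⟩
    (y + ℕtoℚ k + 1ℚ) * fall (y + ℕtoℚ k) (suc k) ≡⟨ cong₂ _*_ (sym shift) (fall-rise y k) ⟩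
    (y + ℕtoℚ (suc k)) * rise y (suc k)          ≡⟨ ℚP.*-comm (y + ℕtoℚ (suc k)) (rise y (suc k)) ⟩
    rise y (suc k) * (y + ℕtoℚ (suc k))          ∎
    where
    open ≡-Reasoning
    shift : y + ℕtoℚ (suc k) ≡ y + ℕtoℚ k + 1ℚ
    shift = trans (cong (y +_) (trans (ℕtoℚ-suc k) (ℚP.+-comm 1ℚ (ℕtoℚ k)))) (sym (ℚP.+-assoc y (ℕtoℚ k) 1ℚ))

  S1std-above : ∀ n j → n ℕ.< j → S1std n j ≡ 0
  S1std-above zero    (suc j) _       = refl
  S1std-above (suc n) (suc j) (s≤s p) =
    trans (cong₂ ℕ._+_ (cong (n ℕ.*_) (S1std-above n (suc j) (ℕP.<-trans p (ℕP.n<1+n j)))) (S1std-above n j p))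
          (trans (ℕP.+-identityʳ _) (ℕP.*-zeroʳ n))

  S1std-diag : ∀ n → S1std n n ≡ 1
  S1std-diag zero    = refl
  S1std-diag (suc n) =
    trans (cong₂ ℕ._+_ (cong (n ℕ.*_) (S1std-above n (suc n) (ℕP.n<1+n n))) (S1std-diag n))
          (cong (ℕ._+ 1) (ℕP.*-zeroʳ n))

  S1-above : ∀ n j → n ℕ.< j → S1 n j ≡ 0
  S1-above n (suc j) p = S1std-above n (suc j) p

  S1-zero : ∀ m → S1 0 m ≡ 0
  S1-zero zero    = refl
  S1-zero (suc m) = refl

  S1-suc : ∀ k j → S1 (suc k) j ≡ S1std (suc k) j
  S1-suc k zero    = refl
  S1-suc k (suc j) = refl

  -- The generating function of the Stirling numbers:
  -- y^{\overline{n}} = Σ_{j ≤ n} S1(n,j) y^j.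
  stirTerm : ℕ → ℚ → ℕ → ℚ
  stirTerm n y j = ℕtoℚ (S1std n j) * powQ y j

  stirTerm-recurrence : ∀ n y j → ℕtoℚ n * stirTerm n y (suc j) + y * stirTerm n y j ≡ stirTerm (suc n) y (suc j)
  stirTerm-recurrence n y j = begin
    ℕtoℚ n * (ℕtoℚ (S1std n (suc j)) * (y * powQ y j)) + y * (ℕtoℚ (S1std n j) * powQ y j)
      ≡⟨ solve 5 (λ a b y p c → a :* (b :* (y :* p)) :+ y :* (c :* p) := (a :* b :+ c) :* (y :* p)) refl
           (ℕtoℚ n) (ℕtoℚ (S1std n (suc j))) y (powQ y j) (ℕtoℚ (S1std n j)) ⟩
    (ℕtoℚ n * ℕtoℚ (S1std n (suc j)) + ℕtoℚ (S1std n j)) * (y * powQ y j)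
      ≡⟨ cong (_* (y * powQ y j)) (sym (trans (ℕtoℚ-+ (n ℕ.* S1std n (suc j)) (S1std n j))
                                               (cong (_+ ℕtoℚ (S1std n j)) (ℕtoℚ-* n _)))) ⟩
    ℕtoℚ (S1std (suc n) (suc j)) * (y * powQ y j) ∎
    where open ≡-Reasoning

  -- n Σ_{j ≤ n} S1(n,j+1) y^{j+1} = n Σ_{j ≤ n} S1(n,j) y^j, since S1(n,n+1) = 0 and n S1(n,0) = 0.
  stirSum-shift : ∀ n y → ℕtoℚ n * sumN (suc n) (stirTerm n y ∘ suc) ≡ ℕtoℚ n * sumN (suc n) (stirTerm n y)
  stirSum-shift n y = begin
    ℕtoℚ n * sumN (suc n) up                          ≡⟨ cong (ℕtoℚ n *_) (trans (sumN-last n up) (cong (sumN n up +_) top)) ⟩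
    ℕtoℚ n * (sumN n up + 0ℚ)                         ≡⟨ solve 2 (λ a x → a :* (x :+ con 0ℚ) := a :* x :+ con 0ℚ) refl (ℕtoℚ n) (sumN n up) ⟩
    ℕtoℚ n * sumN n up + 0ℚ                           ≡⟨ cong (ℕtoℚ n * sumN n up +_) (sym (n*S1std0 n)) ⟩
    ℕtoℚ n * sumN n up + ℕtoℚ n * ℕtoℚ (S1std n 0)
      ≡⟨ solve 3 (λ a x s → a :* x :+ a :* s := a :* (s :* con 1ℚ :+ x)) refl (ℕtoℚ n) (sumN n up) (ℕtoℚ (S1std n 0)) ⟩
    ℕtoℚ n * sumN (suc n) (stirTerm n y)              ∎
    where
    open ≡-Reasoning
    up = stirTerm n y ∘ suc
    top : up n ≡ 0ℚ
    top = trans (cong (λ z → ℕtoℚ z * powQ y (suc n)) (S1std-above n (suc n) (ℕP.n<1+n n))) (ℚP.*-zeroˡ (powQ y (suc n)))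
    n*S1std0 : ∀ n → ℕtoℚ n * ℕtoℚ (S1std n 0) ≡ 0ℚ
    n*S1std0 zero    = refl
    n*S1std0 (suc n) = ℚP.*-zeroʳ (ℕtoℚ (suc n))

  rise-stirling : ∀ y n → rise y n ≡ sumN (suc n) (stirTerm n y)
  rise-stirling y zero    = solve 1 (λ y → con 1ℚ := con 1ℚ :* con 1ℚ :+ con 0ℚ) refl y
  rise-stirling y (suc n) = begin
    rise y n * (y + ℕtoℚ n)                                       ≡⟨ cong (_* (y + ℕtoℚ n)) (rise-stirling y n) ⟩
    P * (y + ℕtoℚ n)                                              ≡⟨ solve 3 (λ p y n → p :* (y :+ n) := n :* p :+ y :* p) refl P y (ℕtoℚ n) ⟩
    ℕtoℚ n * P + y * P                                            ≡⟨ cong (_+ y * P) (sym (stirSum-shift n y)) ⟩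
    ℕtoℚ n * sumN (suc n) (stirTerm n y ∘ suc) + y * P
      ≡⟨ cong₂ _+_ (sumN-*ˡ (suc n) (ℕtoℚ n) (stirTerm n y ∘ suc)) (sumN-*ˡ (suc n) y (stirTerm n y)) ⟩
    sumN (suc n) (λ j → ℕtoℚ n * stirTerm n y (suc j)) + sumN (suc n) (λ j → y * stirTerm n y j)
      ≡⟨ sym (sumN-∙ (suc n) (λ j → ℕtoℚ n * stirTerm n y (suc j)) (λ j → y * stirTerm n y j)) ⟩
    sumN (suc n) (λ j → ℕtoℚ n * stirTerm n y (suc j) + y * stirTerm n y j) ≡⟨ sumN-cong (suc n) (λ j _ → stirTerm-recurrence n y j) ⟩
    sumN (suc n) (λ j → stirTerm (suc n) y (suc j))               ≡⟨ sym (ℚP.+-identityˡ _) ⟩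
    stirTerm (suc n) y 0 + sumN (suc n) (λ j → stirTerm (suc n) y (suc j)) ∎
    where
    open ≡-Reasoning
    P = sumN (suc n) (stirTerm n y)

  binom-stirling : ∀ y k M → suc (suc k) ℕ.≤ M →
    binomQ (y + ℕtoℚ k) (suc k) ≡ invFact (suc k) * sumN M (λ j → ℕtoℚ (S1 (suc k) j) * powQ y j)
  binom-stirling y k M le = begin
    binomQ (y + ℕtoℚ k) (suc k)                                  ≡⟨ binom-fall _ (suc k) ⟩
    fall (y + ℕtoℚ k) (suc k) * invFact (suc k)
      ≡⟨ cong (_* invFact (suc k)) (trans (fall-rise y k) (rise-stirling y (suc k))) ⟩
    sumN (suc (suc k)) (stirTerm (suc k) y) * invFact (suc k)    ≡⟨ ℚP.*-comm _ (invFact (suc k)) ⟩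
    invFact (suc k) * sumN (suc (suc k)) (stirTerm (suc k) y)
      ≡⟨ cong (invFact (suc k) *_) (sumN-cong (suc (suc k)) (λ j _ → cong (λ z → ℕtoℚ z * powQ y j) (sym (S1-suc k j)))) ⟩
    invFact (suc k) * sumN (suc (suc k)) term                    ≡⟨ cong (invFact (suc k) *_) (sym (sumN-vanish (suc (suc k)) M term le vanish)) ⟩
    invFact (suc k) * sumN M term                                ∎
    where
    open ≡-Reasoning
    term : ℕ → ℚ
    term j = ℕtoℚ (S1 (suc k) j) * powQ y j
    vanish : ∀ i → suc (suc k) ℕ.≤ i → i ℕ.< M → term i ≡ 0ℚ
    vanish i p _ = trans (cong (λ z → ℕtoℚ z * powQ y i) (S1-above (suc k) i p)) (ℚP.*-zeroˡ (powQ y i))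

  binomialTerm : ℚ → ℚ → ℕ → ℕ → ℚ
  binomialTerm u v j m = ℕtoℚ (j C m) * powQ u m * powQ v (j ∸ m)

  binomialTerm-above : ∀ u v j m → j ℕ.< m → binomialTerm u v j m ≡ 0ℚ
  binomialTerm-above u v j m p = trans (cong (λ z → ℕtoℚ z * powQ u m * powQ v (j ∸ m)) (k>n⇒nCk≡0 p))
    (solve 2 (λ a b → con 0ℚ :* a :* b := con 0ℚ) refl (powQ u m) (powQ v (j ∸ m)))

  -- v · C(j,m+1) u^{m+1} v^{j-(m+1)}, with the exponent of v written as j - m.
  shiftedTerm : ℚ → ℚ → ℕ → ℕ → ℚ
  shiftedTerm u v j m = ℕtoℚ (j C suc m) * powQ u (suc m) * powQ v (j ∸ m)

  v*binomialSum : ∀ u v j → v * sumN (suc j) (binomialTerm u v j) ≡ powQ v (suc j) + sumN j (shiftedTerm u v j)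
  v*binomialSum u v j = begin
    v * (binomialTerm u v j 0 + sumN j (λ m → binomialTerm u v j (suc m)))      ≡⟨ ℚP.*-distribˡ-+ v _ _ ⟩
    v * (1ℚ * 1ℚ * powQ v j) + v * sumN j (λ m → binomialTerm u v j (suc m))
      ≡⟨ cong₂ _+_ (solve 2 (λ v p → v :* (con 1ℚ :* con 1ℚ :* p) := v :* p) refl v (powQ v j))
                   (sumN-*ˡ j v (λ m → binomialTerm u v j (suc m))) ⟩
    powQ v (suc j) + sumN j (λ m → v * binomialTerm u v j (suc m))
      ≡⟨ cong (powQ v (suc j) +_) (sumN-cong j (λ m p → trans
            (solve 4 (λ v c a b → v :* (c :* a :* b) := c :* a :* (v :* b)) refl v (ℕtoℚ (j C suc m)) (powQ u (suc m)) (powQ v (j ∸ suc m)))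
            (cong (λ z → ℕtoℚ (j C suc m) * powQ u (suc m) * powQ v z) (sym (ℕP.+-∸-assoc 1 p))))) ⟩
    powQ v (suc j) + sumN j (shiftedTerm u v j) ∎
    where open ≡-Reasoning

  shiftedTerm-last : ∀ u v j → shiftedTerm u v j j ≡ 0ℚ
  shiftedTerm-last u v j = trans (cong (λ z → ℕtoℚ z * powQ u (suc j) * powQ v (j ∸ j)) (k>n⇒nCk≡0 (ℕP.n<1+n j)))
    (solve 2 (λ a b → con 0ℚ :* a :* b := con 0ℚ) refl (powQ u (suc j)) (powQ v (j ∸ j)))

  binomialTerm-pascal : ∀ u v j m → u * binomialTerm u v j m + shiftedTerm u v j m ≡ binomialTerm u v (suc j) (suc m)
  binomialTerm-pascal u v j m = trans
    (solve 5 (λ u a b c d → u :* (a :* b :* c) :+ d :* (u :* b) :* c := (a :+ d) :* (u :* b) :* c) refl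
       u (ℕtoℚ (j C m)) (powQ u m) (powQ v (j ∸ m)) (ℕtoℚ (j C suc m)))
    (cong (λ z → z * powQ u (suc m) * powQ v (j ∸ m))
      (trans (sym (ℕtoℚ-+ (j C m) (j C suc m))) (cong ℕtoℚ (nCk+nC[k+1]≡[n+1]C[k+1] j m))))

  binomial-theorem : ∀ u v j → powQ (u + v) j ≡ sumN (suc j) (binomialTerm u v j)
  binomial-theorem u v zero    = solve 2 (λ u v → con 1ℚ := con 1ℚ :* con 1ℚ :* con 1ℚ :+ con 0ℚ) refl u v
  binomial-theorem u v (suc j) = begin
    (u + v) * powQ (u + v) j                          ≡⟨ cong ((u + v) *_) (binomial-theorem u v j) ⟩
    (u + v) * S                                       ≡⟨ ℚP.*-distribʳ-+ S u v ⟩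
    u * S + v * S                                     ≡⟨ cong₂ _+_ (sumN-*ˡ (suc j) u (binomialTerm u v j)) (v*binomialSum u v j) ⟩
    U + (powQ v (suc j) + sumN j shifted)
      ≡⟨ solve 3 (λ a b c → a :+ (b :+ c) := b :+ (a :+ c)) refl U (powQ v (suc j)) (sumN j shifted) ⟩
    powQ v (suc j) + (U + sumN j shifted)
      ≡⟨ cong (λ z → powQ v (suc j) + (U + z)) (sym (trans (sumN-last j shifted)
            (trans (cong (sumN j shifted +_) (shiftedTerm-last u v j)) (ℚP.+-identityʳ _)))) ⟩
    powQ v (suc j) + (U + sumN (suc j) shifted)
      ≡⟨ cong (powQ v (suc j) +_) (sym (sumN-∙ (suc j) (λ m → u * binomialTerm u v j m) shifted)) ⟩
    powQ v (suc j) + sumN (suc j) (λ m → u * binomialTerm u v j m + shifted m)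
      ≡⟨ cong₂ _+_ (solve 1 (λ p → p := con 1ℚ :* con 1ℚ :* p) refl (powQ v (suc j)))
                   (sumN-cong (suc j) (λ m _ → binomialTerm-pascal u v j m)) ⟩
    binomialTerm u v (suc j) 0 + sumN (suc j) (λ m → binomialTerm u v (suc j) (suc m)) ∎
    where
    open ≡-Reasoning
    S = sumN (suc j) (binomialTerm u v j)
    U = sumN (suc j) (λ m → u * binomialTerm u v j m)
    shifted = shiftedTerm u v j

  binomial-theorem-padded : ∀ u v j M → j ℕ.< M → powQ (u + v) j ≡ sumN M (binomialTerm u v j)
  binomial-theorem-padded u v j M le = trans (binomial-theorem u v j)
    (sym (sumN-vanish (suc j) M (binomialTerm u v j) le (λ m p _ → binomialTerm-above u v j m p)))

  choose-fact : ∀ {j m} → m ℕ.≤ j → ℕtoℚ (j C m) * ℕtoℚ (m ℕ.!) ≡ ℕtoℚ (j ℕ.!) * invFact (j ∸ m)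
  choose-fact {j} {m} le = begin
    ℕtoℚ (j C m) * ℕtoℚ (m ℕ.!)                                  ≡⟨ sym (ℚP.*-identityʳ _) ⟩
    ℕtoℚ (j C m) * ℕtoℚ (m ℕ.!) * 1ℚ
      ≡⟨ cong (ℕtoℚ (j C m) * ℕtoℚ (m ℕ.!) *_) (sym (trans (ℚP.*-comm (ℕtoℚ ((j ∸ m) ℕ.!)) i) (invFact-* (j ∸ m)))) ⟩
    ℕtoℚ (j C m) * ℕtoℚ (m ℕ.!) * (ℕtoℚ ((j ∸ m) ℕ.!) * i)
      ≡⟨ solve 4 (λ a b f i → a :* b :* (f :* i) := a :* (b :* f) :* i) refl (ℕtoℚ (j C m)) (ℕtoℚ (m ℕ.!)) (ℕtoℚ ((j ∸ m) ℕ.!)) i ⟩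
    ℕtoℚ (j C m) * (ℕtoℚ (m ℕ.!) * ℕtoℚ ((j ∸ m) ℕ.!)) * i
      ≡⟨ cong (_* i) (sym (trans (ℕtoℚ-* (j C m) _) (cong (ℕtoℚ (j C m) *_) (ℕtoℚ-* (m ℕ.!) ((j ∸ m) ℕ.!))))) ⟩
    ℕtoℚ ((j C m) ℕ.* (m ℕ.! ℕ.* (j ∸ m) ℕ.!)) * i                 ≡⟨ cong (λ z → ℕtoℚ z * i) natural ⟩
    ℕtoℚ (j ℕ.!) * i                                              ∎
    where
    open ≡-Reasoning
    i = invFact (j ∸ m)
    natural : (j C m) ℕ.* (m ℕ.! ℕ.* (j ∸ m) ℕ.!) ≡ j ℕ.!
    natural = trans (cong (ℕ._* (m ℕ.! ℕ.* (j ∸ m) ℕ.!)) (nCk≡n!/k![n-k]! le))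
                    (m/n*n≡m {{ℕP._!*_!≢0 m (j ∸ m)}} (k![n∸k]!∣n! le))

  pascal : ∀ x j → binomQ (x + 1ℚ) (suc j) ≡ binomQ x (suc j) + binomQ x j
  pascal x j = begin
    binomQ (x + 1ℚ) (suc j)                           ≡⟨ binom-fall (x + 1ℚ) (suc j) ⟩
    fall (x + 1ℚ) (suc j) * invFact (suc j)           ≡⟨ cong₂ _*_ (fall-shift x j) (invFact-suc j) ⟩
    (x + 1ℚ) * F * (I * u)
      ≡⟨ solve 5 (λ x F I u n → (x :+ con 1ℚ) :* F :* (I :* u) := F :* (x :- n) :* (I :* u) :+ F :* I :* (u :* (con 1ℚ :+ n)))
           refl x F I u (ℕtoℚ j) ⟩
    F * (x - ℕtoℚ j) * (I * u) + F * I * (u * (1ℚ + ℕtoℚ j))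
      ≡⟨ cong (λ z → F * (x - ℕtoℚ j) * (I * u) + F * I * z) (trans (cong (u *_) (sym (ℕtoℚ-suc j))) (inv-* (suc j))) ⟩
    F * (x - ℕtoℚ j) * (I * u) + F * I * 1ℚ
      ≡⟨ cong₂ _+_ (cong (F * (x - ℕtoℚ j) *_) (sym (invFact-suc j))) (ℚP.*-identityʳ (F * I)) ⟩
    fall x (suc j) * invFact (suc j) + F * I          ≡⟨ cong₂ _+_ (sym (binom-fall x (suc j))) (sym (binom-fall x j)) ⟩
    binomQ x (suc j) + binomQ x j                     ∎
    where
    open ≡-Reasoning
    F = fall x j
    I = invFact j
    u = inv (suc j)

  binom-one : ∀ x → binomQ x 1 ≡ x
  binom-one x = solve 1 (λ x → con 1ℚ :* (x :- con 0ℚ) :* con 1ℚ := x) refl x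

  binom-overflow : ∀ k → binomQ (ℕtoℚ (suc k)) (suc (suc k)) ≡ 0ℚ
  binom-overflow k =
    trans (cong (λ z → binomQ (ℕtoℚ (suc k)) (suc k) * z * inv (suc (suc k))) (ℚP.+-inverseʳ (ℕtoℚ (suc k))))
          (solve 2 (λ a b → a :* con 0ℚ :* b := con 0ℚ) refl (binomQ (ℕtoℚ (suc k)) (suc k)) (inv (suc (suc k))))

-- Expanding binom(y+k, k+1) by Stirling numbers and (βq + c_k)^j by the
-- binomial theorem, the right-hand side becomes Σ_m (βq)^m T_m and the
-- left-hand side Σ_m q^m β^ℓ A_m (see rhsCoeff and lhsCoeff below).  The
-- recursion defining c_m says exactly that T_m = β^{ℓ-m} A_m.
module PolynomialIdentity where

  open import Defs
  open import Data.Nat as ℕ using (ℕ; suc; _∸_; s≤s)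
  import Data.Nat.Properties as ℕP
  open import Data.Nat.Combinatorics using (_C_; nCn≡1; k>n⇒nCk≡0; nCk≡nC[n∸k]; nC1≡n)
  open import Data.Rational using (ℚ; 0ℚ; 1ℚ; _+_; _*_; _-_)
  import Data.Rational.Properties as ℚP
  open import Data.Sum using ([_,_]′)
  open import Function using (_∘_)
  open import Relation.Binary.PropositionalEquality
  open import Data.Rational.Solver using (module +-*-Solver)
  open +-*-Solver
  open Rationals
  open FiniteSums
  open ℚΣ
  open Polynomials

  -- The final algebraic step of rhsCoeff-lhsCoeff below, with i = 1/m!, f = m!.
  cancel-inverse : ∀ a i f B r → i * f ≡ 1ℚ → a + (0ℚ + (i * (f * (B - 1ℚ) * a - f * r) + r)) ≡ B * a
  cancel-inverse a i f B r i*f≡1 = begin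
    a + (0ℚ + (i * (f * (B - 1ℚ) * a - f * r) + r))
      ≡⟨ solve 5 (λ a i f B r → a :+ (con 0ℚ :+ (i :* (f :* (B :- con 1ℚ) :* a :- f :* r) :+ r))
                      := B :* a :+ (i :* f :- con 1ℚ) :* ((B :- con 1ℚ) :* a :- r)) refl a i f B r ⟩
    B * a + (i * f - 1ℚ) * ((B - 1ℚ) * a - r)   ≡⟨ cong (λ z → B * a + (z - 1ℚ) * ((B - 1ℚ) * a - r)) i*f≡1 ⟩
    B * a + (1ℚ - 1ℚ) * ((B - 1ℚ) * a - r)      ≡⟨ solve 2 (λ x y → x :+ (con 1ℚ :- con 1ℚ) :* y := x) refl (B * a) ((B - 1ℚ) * a - r) ⟩
    B * a                                       ∎
    where open ≡-Reasoning

  module CoefficientComparison (L β : ℕ) (c : ℕ → ℚ)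
    (recursion : ∀ m → m ℕ.< suc L → c m ≡ cFormula (suc L) β c m) where

    ℓ = suc L
    N = suc ℓ
    b = ℕtoℚ β

    -- Contribution of the monomial (βq)^m in binom(βq + c_k + k, k+1) coming from y^j, y = βq + c_k.
    coeffTerm : ℕ → ℕ → ℕ → ℚ
    coeffTerm m k j = invFact (suc k) * ℕtoℚ (S1 (suc k) j) * ℕtoℚ (j C m) * powQ (c k) (j ∸ m)

    -- T_m: coefficient of (βq)^m on the right; A_m: coefficient of q^m in Σ_k binom(q+k, k+1).
    rhsCoeff lhsCoeff : ℕ → ℚ
    rhsCoeff m = sumN ℓ (λ k → sumN N (coeffTerm m k))
    lhsCoeff m = sumN ℓ (λ k → invFact (suc k) * ℕtoℚ (S1 (suc k) m))

    tailCoeff : ℕ → ℕ → ℚ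
    tailCoeff m k = sumN (ℓ ∸ m) (λ u → coeffTerm m k (suc (m ℕ.+ u)))

    coeffTerm-S1-zero : ∀ m k j → S1 (suc k) j ≡ 0 → coeffTerm m k j ≡ 0ℚ
    coeffTerm-S1-zero m k j e = trans (cong (λ z → invFact (suc k) * ℕtoℚ z * ℕtoℚ (j C m) * powQ (c k) (j ∸ m)) e)
      (solve 3 (λ a b d → a :* con 0ℚ :* b :* d := con 0ℚ) refl (invFact (suc k)) (ℕtoℚ (j C m)) (powQ (c k) (j ∸ m)))

    -- Σ_j coeffTerm m k j = S1(k+1,m)/(k+1)! + tailCoeff m k   (terms j < m vanish, j = m is the diagonal).
    coeffSum-split : ∀ m k → m ℕ.≤ ℓ → sumN N (coeffTerm m k) ≡ invFact (suc k) * ℕtoℚ (S1 (suc k) m) + tailCoeff m k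
    coeffSum-split m k le = begin
      sumN N (coeffTerm m k)                                         ≡⟨ sumN-peel m N (coeffTerm m k) (s≤s le) ⟩
      sumN m (coeffTerm m k) + (coeffTerm m k m + tailCoeff m k)     ≡⟨ cong₂ (λ x y → x + (y + tailCoeff m k)) below diagonal ⟩
      0ℚ + (invFact (suc k) * ℕtoℚ (S1 (suc k) m) + tailCoeff m k)   ≡⟨ ℚP.+-identityˡ _ ⟩
      invFact (suc k) * ℕtoℚ (S1 (suc k) m) + tailCoeff m k          ∎
      where
      open ≡-Reasoning
      below : sumN m (coeffTerm m k) ≡ 0ℚ
      below = sumN-0 m (λ j p → trans (cong (λ z → invFact (suc k) * ℕtoℚ (S1 (suc k) j) * ℕtoℚ z * powQ (c k) (j ∸ m)) (k>n⇒nCk≡0 p))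
        (solve 3 (λ a b d → a :* b :* con 0ℚ :* d := con 0ℚ) refl (invFact (suc k)) (ℕtoℚ (S1 (suc k) j)) (powQ (c k) (j ∸ m))))
      diagonal : coeffTerm m k m ≡ invFact (suc k) * ℕtoℚ (S1 (suc k) m)
      diagonal = trans (cong₂ (λ z w → invFact (suc k) * ℕtoℚ (S1 (suc k) m) * ℕtoℚ z * powQ (c k) w) (nCn≡1 m) (ℕP.n∸n≡0 m))
        (solve 2 (λ a b → a :* b :* con 1ℚ :* con 1ℚ := a :* b) refl (invFact (suc k)) (ℕtoℚ (S1 (suc k) m)))

    rhsCoeff-split : ∀ m → m ℕ.≤ ℓ → rhsCoeff m ≡ lhsCoeff m + sumN ℓ (tailCoeff m)
    rhsCoeff-split m le = trans (sumN-cong ℓ (λ k _ → coeffSum-split m k le))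
      (sumN-∙ ℓ (λ k → invFact (suc k) * ℕtoℚ (S1 (suc k) m)) (tailCoeff m))

    -- For k < m every term of the tail has j > k+1, so S1(k+1,j) = 0.
    tailCoeff-below : ∀ m k → k ℕ.< m → tailCoeff m k ≡ 0ℚ
    tailCoeff-below m k k<m = sumN-0 (ℓ ∸ m) (λ u _ → coeffTerm-S1-zero m k (suc (m ℕ.+ u))
      (S1-above (suc k) (suc (m ℕ.+ u)) (s≤s (ℕP.<-≤-trans k<m (ℕP.m≤m+n m u)))))

    -- For k = m only j = m+1 survives, giving S1(m+1,m+1) (m+1) c_m /(m+1)! = c_m / m!.
    tailCoeff-diagonal : ∀ m → m ℕ.< ℓ → tailCoeff m m ≡ invFact m * c m
    tailCoeff-diagonal m m<ℓ = begin
      tailCoeff m m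
        ≡⟨ sumN-single (ℓ ∸ m) 0 _ (ℕP.m<n⇒0<n∸m m<ℓ) (λ u _ u≢0 → coeffTerm-S1-zero m m (suc (m ℕ.+ u))
             (S1-above (suc m) (suc (m ℕ.+ u)) (s≤s (ℕP.m<m+n m (ℕP.n≢0⇒n>0 u≢0))))) ⟩
      coeffTerm m m (suc (m ℕ.+ 0))                                       ≡⟨ cong (coeffTerm m m ∘ suc) (ℕP.+-identityʳ m) ⟩
      invFact (suc m) * ℕtoℚ (S1 (suc m) (suc m)) * ℕtoℚ (suc m C m) * powQ (c m) (suc m ∸ m)
        ≡⟨ cong₂ (λ s e → invFact (suc m) * ℕtoℚ s * ℕtoℚ (suc m C m) * powQ (c m) e) (S1std-diag (suc m)) (ℕP.m+n∸n≡m 1 m) ⟩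
      invFact (suc m) * 1ℚ * ℕtoℚ (suc m C m) * powQ (c m) 1
        ≡⟨ cong₂ (λ f z → f * 1ℚ * ℕtoℚ z * powQ (c m) 1) (invFact-suc m) m+1Cm ⟩
      invFact m * inv (suc m) * 1ℚ * ℕtoℚ (suc m) * powQ (c m) 1
        ≡⟨ solve 4 (λ f i n c → f :* i :* con 1ℚ :* n :* (c :* con 1ℚ) := f :* c :* (i :* n)) refl (invFact m) (inv (suc m)) (ℕtoℚ (suc m)) (c m) ⟩
      invFact m * c m * (inv (suc m) * ℕtoℚ (suc m))                      ≡⟨ cong (invFact m * c m *_) (inv-* (suc m)) ⟩
      invFact m * c m * 1ℚ                                                ≡⟨ ℚP.*-identityʳ (invFact m * c m) ⟩
      invFact m * c m                                                     ∎
      where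
      open ≡-Reasoning
      m+1Cm : suc m C m ≡ suc m
      m+1Cm = trans (nCk≡nC[n∸k] (ℕP.n≤1+n m)) (trans (cong (suc m C_) (ℕP.m+n∸n≡m 1 m)) (nC1≡n (suc m)))

    -- The tail over k > m, which the double sum of the recursion computes.
    tailAbove : ℕ → ℚ
    tailAbove m = sumN (ℓ ∸ suc m) (λ t → tailCoeff m (suc (m ℕ.+ t)))

    recTerm : ℕ → ℕ → ℕ → ℚ
    recTerm m i j = ℕtoℚ (S1 i j ℕ.* (j ℕ.!)) * invFact i * invFact (j ∸ m) * powQ (c (i ∸ 1)) (j ∸ m)

    recDoubleSum : ℕ → ℚ
    recDoubleSum m = Σ[ suc (suc m) to ℓ ] (λ i → Σ[ suc m to i ] (recTerm m i))

    -- Each of its terms is m! times a term of the tail:  S1(i,j) j!/(i!(j-m)!) = m! S1(i,j) C(j,m)/i!.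
    recTerm-coeffTerm : ∀ m k j → m ℕ.≤ j → recTerm m (suc k) j ≡ ℕtoℚ (m ℕ.!) * coeffTerm m k j
    recTerm-coeffTerm m k j le = begin
      ℕtoℚ (S1 (suc k) j ℕ.* j ℕ.!) * invFact (suc k) * invFact (j ∸ m) * powQ (c k) (j ∸ m)
        ≡⟨ cong (λ z → z * invFact (suc k) * invFact (j ∸ m) * powQ (c k) (j ∸ m)) (ℕtoℚ-* (S1 (suc k) j) (j ℕ.!)) ⟩
      ℕtoℚ (S1 (suc k) j) * ℕtoℚ (j ℕ.!) * invFact (suc k) * invFact (j ∸ m) * powQ (c k) (j ∸ m)
        ≡⟨ solve 5 (λ s f a i p → s :* f :* a :* i :* p := a :* s :* (f :* i) :* p) refl
             (ℕtoℚ (S1 (suc k) j)) (ℕtoℚ (j ℕ.!)) (invFact (suc k)) (invFact (j ∸ m)) (powQ (c k) (j ∸ m)) ⟩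
      invFact (suc k) * ℕtoℚ (S1 (suc k) j) * (ℕtoℚ (j ℕ.!) * invFact (j ∸ m)) * powQ (c k) (j ∸ m)
        ≡⟨ cong (λ z → invFact (suc k) * ℕtoℚ (S1 (suc k) j) * z * powQ (c k) (j ∸ m)) (sym (choose-fact le)) ⟩
      invFact (suc k) * ℕtoℚ (S1 (suc k) j) * (ℕtoℚ (j C m) * ℕtoℚ (m ℕ.!)) * powQ (c k) (j ∸ m)
        ≡⟨ solve 5 (λ a s x f p → a :* s :* (x :* f) :* p := f :* (a :* s :* x :* p)) refl
             (invFact (suc k)) (ℕtoℚ (S1 (suc k) j)) (ℕtoℚ (j C m)) (ℕtoℚ (m ℕ.!)) (powQ (c k) (j ∸ m)) ⟩
      ℕtoℚ (m ℕ.!) * coeffTerm m k j ∎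
      where open ≡-Reasoning

    recDoubleSum-tail : ∀ m → m ℕ.< ℓ → recDoubleSum m ≡ ℕtoℚ (m ℕ.!) * tailAbove m
    recDoubleSum-tail m m<ℓ = begin
      recDoubleSum m                       ≡⟨ Σ-to (suc (suc m)) ℓ (λ i → Σ[ suc m to i ] (recTerm m i)) ⟩
      sumN (ℓ ∸ suc m) (λ t → Σ[ suc m to i t ] (recTerm m (i t)))
        ≡⟨ sumN-cong (ℓ ∸ suc m) inner ⟩
      sumN (ℓ ∸ suc m) (λ t → ℕtoℚ (m ℕ.!) * tailCoeff m (suc (m ℕ.+ t)))
        ≡⟨ sym (sumN-*ˡ (ℓ ∸ suc m) (ℕtoℚ (m ℕ.!)) (λ t → tailCoeff m (suc (m ℕ.+ t)))) ⟩
      ℕtoℚ (m ℕ.!) * tailAbove m ∎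
      where
      open ≡-Reasoning
      i : ℕ → ℕ
      i t = suc (suc (m ℕ.+ t))
      inner : ∀ t → t ℕ.< ℓ ∸ suc m → Σ[ suc m to i t ] (recTerm m (i t)) ≡ ℕtoℚ (m ℕ.!) * tailCoeff m (suc (m ℕ.+ t))
      inner t p = begin
        Σ[ suc m to i t ] (recTerm m (i t))            ≡⟨ Σ-to (suc m) (i t) (recTerm m (i t)) ⟩
        sumN (i t ∸ m) (λ u → recTerm m (i t) (suc (m ℕ.+ u)))
          ≡⟨ cong (λ z → sumN z (λ u → recTerm m (i t) (suc (m ℕ.+ u)))) i∸m ⟩
        sumN (suc (suc t)) (λ u → recTerm m (i t) (suc (m ℕ.+ u)))
          ≡⟨ sumN-cong (suc (suc t)) (λ u _ → recTerm-coeffTerm m (suc (m ℕ.+ t)) (suc (m ℕ.+ u)) (ℕP.≤-trans (ℕP.m≤m+n m u) (ℕP.n≤1+n _))) ⟩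
        sumN (suc (suc t)) (λ u → ℕtoℚ (m ℕ.!) * coeffTerm m (suc (m ℕ.+ t)) (suc (m ℕ.+ u)))
          ≡⟨ sym (sumN-*ˡ (suc (suc t)) (ℕtoℚ (m ℕ.!)) (λ u → coeffTerm m (suc (m ℕ.+ t)) (suc (m ℕ.+ u)))) ⟩
        ℕtoℚ (m ℕ.!) * sumN (suc (suc t)) (λ u → coeffTerm m (suc (m ℕ.+ t)) (suc (m ℕ.+ u)))
          ≡⟨ cong (ℕtoℚ (m ℕ.!) *_) (sym (sumN-vanish (suc (suc t)) (ℓ ∸ m) _ room vanish)) ⟩
        ℕtoℚ (m ℕ.!) * tailCoeff m (suc (m ℕ.+ t)) ∎
        where
        i∸m : i t ∸ m ≡ suc (suc t)
        i∸m = trans (cong (_∸ m) (sym (trans (ℕP.+-suc m (suc t)) (cong suc (ℕP.+-suc m t))))) (ℕP.m+n∸m≡n m (suc (suc t)))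
        room : suc (suc t) ℕ.≤ ℓ ∸ m
        room = subst (suc (suc t) ℕ.≤_) (sym (ℕP.+-∸-assoc 1 m<ℓ)) (s≤s p)
        vanish : ∀ u → suc (suc t) ℕ.≤ u → u ℕ.< ℓ ∸ m → coeffTerm m (suc (m ℕ.+ t)) (suc (m ℕ.+ u)) ≡ 0ℚ
        vanish u q _ = coeffTerm-S1-zero m (suc (m ℕ.+ t)) (suc (m ℕ.+ u)) (S1-above (i t) (suc (m ℕ.+ u))
          (s≤s (subst (ℕ._≤ m ℕ.+ u) (trans (ℕP.+-suc m (suc t)) (cong suc (ℕP.+-suc m t))) (ℕP.+-monoʳ-≤ m q))))

    recSingleSum-lhsCoeff : ∀ m → m ℕ.≤ ℓ → Σ[ m to ℓ ] (λ i → ℕtoℚ (S1 i m) * invFact i) ≡ lhsCoeff m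
    recSingleSum-lhsCoeff m le = begin
      Σ[ m to ℓ ] f                                           ≡⟨ Σ-to m ℓ f ⟩
      sumN (N ∸ m) (λ u → f (m ℕ.+ u))                        ≡⟨ sym (ℚP.+-identityˡ _) ⟩
      0ℚ + sumN (N ∸ m) (λ u → f (m ℕ.+ u))                   ≡⟨ cong (_+ sumN (N ∸ m) (λ u → f (m ℕ.+ u))) (sym below) ⟩
      sumN m f + sumN (N ∸ m) (λ u → f (m ℕ.+ u))             ≡⟨ sym (sumN-split m (N ∸ m) f) ⟩
      sumN (m ℕ.+ (N ∸ m)) f                                  ≡⟨ cong (λ z → sumN z f) (ℕP.m+[n∸m]≡n (ℕP.m≤n⇒m≤1+n le)) ⟩
      f 0 + sumN ℓ (f ∘ suc)                                  ≡⟨ cong (_+ sumN ℓ (f ∘ suc)) f0 ⟩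
      0ℚ + sumN ℓ (f ∘ suc)                                   ≡⟨ ℚP.+-identityˡ _ ⟩
      sumN ℓ (f ∘ suc)                                        ≡⟨ sumN-cong ℓ (λ k _ → ℚP.*-comm (ℕtoℚ (S1 (suc k) m)) (invFact (suc k))) ⟩
      lhsCoeff m                                              ∎
      where
      open ≡-Reasoning
      f : ℕ → ℚ
      f i = ℕtoℚ (S1 i m) * invFact i
      below : sumN m f ≡ 0ℚ
      below = sumN-0 m (λ i p → trans (cong (λ z → ℕtoℚ z * invFact i) (S1-above i m p)) (ℚP.*-zeroˡ (invFact i)))
      f0 : f 0 ≡ 0ℚ
      f0 = trans (cong (λ z → ℕtoℚ z * invFact 0) (S1-zero m)) (ℚP.*-zeroˡ (invFact 0))

    -- For m = ℓ there is no tail: T_ℓ = A_ℓ.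
    rhsCoeff-top : rhsCoeff ℓ ≡ powQ b (ℓ ∸ ℓ) * lhsCoeff ℓ
    rhsCoeff-top = begin
      rhsCoeff ℓ                              ≡⟨ rhsCoeff-split ℓ ℕP.≤-refl ⟩
      lhsCoeff ℓ + sumN ℓ (tailCoeff ℓ)
        ≡⟨ cong (lhsCoeff ℓ +_) (sumN-0 ℓ (λ k _ → cong (λ z → sumN z (λ u → coeffTerm ℓ k (suc (ℓ ℕ.+ u)))) (ℕP.n∸n≡0 ℓ))) ⟩
      lhsCoeff ℓ + 0ℚ                         ≡⟨ solve 1 (λ a → a :+ con 0ℚ := con 1ℚ :* a) refl (lhsCoeff ℓ) ⟩
      1ℚ * lhsCoeff ℓ                         ≡⟨ cong (λ z → powQ b z * lhsCoeff ℓ) (sym (ℕP.n∸n≡0 ℓ)) ⟩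
      powQ b (ℓ ∸ ℓ) * lhsCoeff ℓ             ∎
      where open ≡-Reasoning

    -- For m < ℓ:  T_m = A_m + c_m/m! + tailAbove m, and the recursion gives c_m/m! = (β^{ℓ-m} - 1) A_m - tailAbove m.
    rhsCoeff-below : ∀ m → m ℕ.< ℓ → rhsCoeff m ≡ powQ b (ℓ ∸ m) * lhsCoeff m
    rhsCoeff-below m m<ℓ = begin
      rhsCoeff m                                                    ≡⟨ rhsCoeff-split m le ⟩
      A + sumN ℓ (tailCoeff m)                                      ≡⟨ cong (A +_) (sumN-peel m ℓ (tailCoeff m) m<ℓ) ⟩
      A + (sumN m (tailCoeff m) + (tailCoeff m m + tailAbove m))
        ≡⟨ cong₂ (λ x y → A + (x + (y + tailAbove m))) (sumN-0 m (tailCoeff-below m)) (tailCoeff-diagonal m m<ℓ) ⟩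
      A + (0ℚ + (invFact m * c m + tailAbove m))
        ≡⟨ cong (λ z → A + (0ℚ + (invFact m * z + tailAbove m))) (recursion m m<ℓ) ⟩
      A + (0ℚ + (invFact m * (ℕtoℚ (m ℕ.!) * (B - 1ℚ) * Σ[ m to ℓ ] (λ i → ℕtoℚ (S1 i m) * invFact i) - recDoubleSum m) + tailAbove m))
        ≡⟨ cong₂ (λ x y → A + (0ℚ + (invFact m * (ℕtoℚ (m ℕ.!) * (B - 1ℚ) * x - y) + tailAbove m)))
             (recSingleSum-lhsCoeff m le) (recDoubleSum-tail m m<ℓ) ⟩
      A + (0ℚ + (invFact m * (ℕtoℚ (m ℕ.!) * (B - 1ℚ) * A - ℕtoℚ (m ℕ.!) * tailAbove m) + tailAbove m))
        ≡⟨ cancel-inverse A (invFact m) (ℕtoℚ (m ℕ.!)) B (tailAbove m) (invFact-* m) ⟩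
      B * A                                                         ∎
      where
      open ≡-Reasoning
      le = ℕP.<⇒≤ m<ℓ
      A = lhsCoeff m
      B = powQ b (ℓ ∸ m)

    rhsCoeff-lhsCoeff : ∀ m → m ℕ.≤ ℓ → rhsCoeff m ≡ powQ b (ℓ ∸ m) * lhsCoeff m
    rhsCoeff-lhsCoeff m le = [ rhsCoeff-below m , (λ m≡ℓ → subst Claim (sym m≡ℓ) rhsCoeff-top) ]′ (ℕP.m≤n⇒m<n∨m≡n le)
      where
      Claim : ℕ → Set
      Claim m = rhsCoeff m ≡ powQ b (ℓ ∸ m) * lhsCoeff m

    rhs-expansion : ∀ q → sumN ℓ (λ k → binomQ (b * q + c k + ℕtoℚ k) (suc k)) ≡ sumN N (λ m → powQ (b * q) m * rhsCoeff m)
    rhs-expansion q = begin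
      sumN ℓ (λ k → binomQ (y k + ℕtoℚ k) (suc k))
        ≡⟨ sumN-cong ℓ (λ k p → binom-stirling (y k) k N (s≤s p)) ⟩
      sumN ℓ (λ k → invFact (suc k) * sumN N (λ j → ℕtoℚ (S1 (suc k) j) * powQ (y k) j))
        ≡⟨ sumN-cong ℓ (λ k _ → cong (invFact (suc k) *_) (sumN-cong N (λ j p →
              cong (ℕtoℚ (S1 (suc k) j) *_) (binomial-theorem-padded (b * q) (c k) j N p)))) ⟩
      sumN ℓ (λ k → invFact (suc k) * sumN N (λ j → ℕtoℚ (S1 (suc k) j) * sumN N (binomialTerm (b * q) (c k) j)))
        ≡⟨ sumN-cong ℓ (λ k _ → regroup k) ⟩
      sumN ℓ (λ k → sumN N (λ m → powQ (b * q) m * sumN N (coeffTerm m k)))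
        ≡⟨ sumN-swap ℓ N (λ k m → powQ (b * q) m * sumN N (coeffTerm m k)) ⟩
      sumN N (λ m → sumN ℓ (λ k → powQ (b * q) m * sumN N (coeffTerm m k)))
        ≡⟨ sumN-cong N (λ m _ → sym (sumN-*ˡ ℓ (powQ (b * q) m) (λ k → sumN N (coeffTerm m k)))) ⟩
      sumN N (λ m → powQ (b * q) m * rhsCoeff m) ∎
      where
      open ≡-Reasoning
      y : ℕ → ℚ
      y k = b * q + c k
      regroup : ∀ k → invFact (suc k) * sumN N (λ j → ℕtoℚ (S1 (suc k) j) * sumN N (binomialTerm (b * q) (c k) j))
                     ≡ sumN N (λ m → powQ (b * q) m * sumN N (coeffTerm m k))
      regroup k = begin
        invFact (suc k) * sumN N (λ j → ℕtoℚ (S1 (suc k) j) * sumN N (binomialTerm (b * q) (c k) j))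
          ≡⟨ sumN-*ˡ N (invFact (suc k)) (λ j → ℕtoℚ (S1 (suc k) j) * sumN N (binomialTerm (b * q) (c k) j)) ⟩
        sumN N (λ j → invFact (suc k) * (ℕtoℚ (S1 (suc k) j) * sumN N (binomialTerm (b * q) (c k) j)))
          ≡⟨ sumN-cong N (λ j _ → trans (sym (ℚP.*-assoc (invFact (suc k)) (ℕtoℚ (S1 (suc k) j)) _))
                                     (sumN-*ˡ N (invFact (suc k) * ℕtoℚ (S1 (suc k) j)) (binomialTerm (b * q) (c k) j))) ⟩
        sumN N (λ j → sumN N (λ m → invFact (suc k) * ℕtoℚ (S1 (suc k) j) * binomialTerm (b * q) (c k) j m))
          ≡⟨ sumN-cong N (λ j _ → sumN-cong N (λ m _ →
               solve 5 (λ i s x p r → i :* s :* (x :* p :* r) := p :* (i :* s :* x :* r)) refl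
                 (invFact (suc k)) (ℕtoℚ (S1 (suc k) j)) (ℕtoℚ (j C m)) (powQ (b * q) m) (powQ (c k) (j ∸ m)))) ⟩
        sumN N (λ j → sumN N (λ m → powQ (b * q) m * coeffTerm m k j))
          ≡⟨ sumN-swap N N (λ j m → powQ (b * q) m * coeffTerm m k j) ⟩
        sumN N (λ m → sumN N (λ j → powQ (b * q) m * coeffTerm m k j))
          ≡⟨ sumN-cong N (λ m _ → sym (sumN-*ˡ N (powQ (b * q) m) (coeffTerm m k))) ⟩
        sumN N (λ m → powQ (b * q) m * sumN N (coeffTerm m k)) ∎

    lhs-expansion : ∀ q → powQ b ℓ * sumN ℓ (λ k → binomQ (q + ℕtoℚ k) (suc k)) ≡ sumN N (λ m → powQ q m * (powQ b ℓ * lhsCoeff m))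
    lhs-expansion q = begin
      powQ b ℓ * sumN ℓ (λ k → binomQ (q + ℕtoℚ k) (suc k))
        ≡⟨ cong (powQ b ℓ *_) (sumN-cong ℓ (λ k p → binom-stirling q k N (s≤s p))) ⟩
      powQ b ℓ * sumN ℓ (λ k → invFact (suc k) * sumN N (λ j → ℕtoℚ (S1 (suc k) j) * powQ q j))
        ≡⟨ cong (powQ b ℓ *_) (trans (sumN-cong ℓ (λ k _ → sumN-*ˡ N (invFact (suc k)) (λ j → ℕtoℚ (S1 (suc k) j) * powQ q j)))
                                     (sumN-swap ℓ N (λ k j → invFact (suc k) * (ℕtoℚ (S1 (suc k) j) * powQ q j)))) ⟩
      powQ b ℓ * sumN N (λ j → sumN ℓ (λ k → invFact (suc k) * (ℕtoℚ (S1 (suc k) j) * powQ q j)))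
        ≡⟨ sumN-*ˡ N (powQ b ℓ) (λ j → sumN ℓ (λ k → invFact (suc k) * (ℕtoℚ (S1 (suc k) j) * powQ q j))) ⟩
      sumN N (λ j → powQ b ℓ * sumN ℓ (λ k → invFact (suc k) * (ℕtoℚ (S1 (suc k) j) * powQ q j)))
        ≡⟨ sumN-cong N (λ j _ → collect j) ⟩
      sumN N (λ m → powQ q m * (powQ b ℓ * lhsCoeff m)) ∎
      where
      open ≡-Reasoning
      collect : ∀ j → powQ b ℓ * sumN ℓ (λ k → invFact (suc k) * (ℕtoℚ (S1 (suc k) j) * powQ q j)) ≡ powQ q j * (powQ b ℓ * lhsCoeff j)
      collect j = begin
        powQ b ℓ * sumN ℓ (λ k → invFact (suc k) * (ℕtoℚ (S1 (suc k) j) * powQ q j))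
          ≡⟨ cong (powQ b ℓ *_) (sumN-cong ℓ (λ k _ → sym (ℚP.*-assoc (invFact (suc k)) (ℕtoℚ (S1 (suc k) j)) (powQ q j)))) ⟩
        powQ b ℓ * sumN ℓ (λ k → invFact (suc k) * ℕtoℚ (S1 (suc k) j) * powQ q j)
          ≡⟨ cong (powQ b ℓ *_) (sym (sumN-*ʳ ℓ (powQ q j) (λ k → invFact (suc k) * ℕtoℚ (S1 (suc k) j)))) ⟩
        powQ b ℓ * (lhsCoeff j * powQ q j)
          ≡⟨ solve 3 (λ x a p → x :* (a :* p) := p :* (x :* a)) refl (powQ b ℓ) (lhsCoeff j) (powQ q j) ⟩
        powQ q j * (powQ b ℓ * lhsCoeff j) ∎

    -- The identity, coefficient by coefficient: q^m β^ℓ A_m = (βq)^m β^{ℓ-m} A_m = (βq)^m T_m.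
    identity : ∀ q → powQ b ℓ * sumN ℓ (λ k → binomQ (q + ℕtoℚ k) (suc k)) ≡ sumN ℓ (λ k → binomQ (b * q + c k + ℕtoℚ k) (suc k))
    identity q = trans (lhs-expansion q) (trans (sumN-cong N (λ m p → coefficient m (ℕP.≤-pred p))) (sym (rhs-expansion q)))
      where
      open ≡-Reasoning
      coefficient : ∀ m → m ℕ.≤ ℓ → powQ q m * (powQ b ℓ * lhsCoeff m) ≡ powQ (b * q) m * rhsCoeff m
      coefficient m le = begin
        powQ q m * (powQ b ℓ * lhsCoeff m)
          ≡⟨ cong (λ z → powQ q m * (powQ b z * lhsCoeff m)) (sym (ℕP.m+[n∸m]≡n le)) ⟩
        powQ q m * (powQ b (m ℕ.+ (ℓ ∸ m)) * lhsCoeff m)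
          ≡⟨ cong (λ z → powQ q m * (z * lhsCoeff m)) (pow-+ b m (ℓ ∸ m)) ⟩
        powQ q m * (powQ b m * powQ b (ℓ ∸ m) * lhsCoeff m)
          ≡⟨ solve 4 (λ x y z a → x :* (y :* z :* a) := y :* x :* (z :* a)) refl (powQ q m) (powQ b m) (powQ b (ℓ ∸ m)) (lhsCoeff m) ⟩
        powQ b m * powQ q m * (powQ b (ℓ ∸ m) * lhsCoeff m)
          ≡⟨ cong₂ _*_ (sym (pow-* b q m)) (sym (rhsCoeff-lhsCoeff m le)) ⟩
        powQ (b * q) m * rhsCoeff m ∎

module CoefficientTable where

  open import Defs
  open import Data.Bool using (if_then_else_)
  open import Data.Nat as ℕ using (ℕ; zero; suc; _∸_; s≤s; _≡ᵇ_)
  import Data.Nat.Properties as ℕP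
  open import Data.Rational as ℚ using (ℚ)
  open import Relation.Binary.PropositionalEquality
  open FiniteSums
  open ℚΣ
  open Booleans

  +-<-∸ : ∀ a t n → t ℕ.< n ∸ a → a ℕ.+ t ℕ.< n
  +-<-∸ zero    t n       p = p
  +-<-∸ (suc a) t (suc n) p = s≤s (+-<-∸ a t n p)

  module _ (ℓ β : ℕ) where

    cTab-stable : ∀ n p j → ℓ ∸ n ℕ.≤ j → p ℕ.+ n ℕ.≤ ℓ → cTab ℓ β (p ℕ.+ n) j ≡ cTab ℓ β n j
    cTab-stable n zero    j le _   = refl
    cTab-stable n (suc p) j le le2 =
      trans (cong (λ b → if b then cFormula ℓ β (cTab ℓ β (p ℕ.+ n)) j else cTab ℓ β (p ℕ.+ n) j) (≡ᵇ-≢ j≢new))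
            (cTab-stable n p j le (ℕP.≤-trans (ℕP.n≤1+n _) le2))
      where
      new<old : ℓ ∸ suc (p ℕ.+ n) ℕ.< ℓ ∸ n
      new<old = ℕP.∸-monoʳ-< (s≤s (ℕP.m≤n+m n p)) le2
      j≢new : j ≢ ℓ ∸ suc (p ℕ.+ n)
      j≢new e = ℕP.<⇒≢ (ℕP.<-≤-trans new<old le) (sym e)

    cFormula-local : ∀ (g g' : ℕ → ℚ) j → (∀ i → suc j ℕ.≤ i → i ℕ.< ℓ → g i ≡ g' i) →
      cFormula ℓ β g j ≡ cFormula ℓ β g' j
    cFormula-local g g' j agree =
      cong (λ z → (ℕtoℚ (j ℕ.!) ℚ.* (powQ (ℕtoℚ β) (ℓ ∸ j) ℚ.- ℚ.1ℚ) ℚ.* Σ[ j to ℓ ] (λ i → ℕtoℚ (S1 i j) ℚ.* invFact i)) ℚ.- z)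
        (trans (Σ-to (suc (suc j)) ℓ (inner g)) (trans (sumN-cong (ℓ ∸ suc j) same) (sym (Σ-to (suc (suc j)) ℓ (inner g')))))
      where
      inner : (ℕ → ℚ) → ℕ → ℚ
      inner h i = Σ[ suc j to i ] (λ jj → ℕtoℚ (S1 i jj ℕ.* (jj ℕ.!)) ℚ.* invFact i ℚ.* invFact (jj ∸ j) ℚ.* powQ (h (i ∸ 1)) (jj ∸ j))
      same : ∀ t → t ℕ.< ℓ ∸ suc j → inner g (suc (suc j) ℕ.+ t) ≡ inner g' (suc (suc j) ℕ.+ t)
      same t p = cong (λ z → Σ[ suc j to suc (suc j) ℕ.+ t ] (λ jj → ℕtoℚ (S1 (suc (suc j) ℕ.+ t) jj ℕ.* (jj ℕ.!))
                               ℚ.* invFact (suc (suc j) ℕ.+ t) ℚ.* invFact (jj ∸ j) ℚ.* powQ z (jj ∸ j)))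
        (agree (suc (j ℕ.+ t)) (s≤s (ℕP.m≤m+n j t)) (+-<-∸ (suc j) t ℓ p))

    -- Unfolding the table: entry j < ℓ is written at step ℓ - j and never changed.
    c-recursion : ∀ j → j ℕ.< ℓ → c ℓ β j ≡ cFormula ℓ β (c ℓ β) j
    c-recursion j j<ℓ = begin
      cTab ℓ β ℓ j                   ≡⟨ cong (λ z → cTab ℓ β z j) (sym j+steps≡ℓ) ⟩
      cTab ℓ β (j ℕ.+ suc n) j       ≡⟨ cTab-stable (suc n) j j (ℕP.≤-reflexive written) (ℕP.≤-reflexive j+steps≡ℓ) ⟩
      cTab ℓ β (suc n) j             ≡⟨ cong (λ b → if b then cFormula ℓ β (cTab ℓ β n) j else cTab ℓ β n j)
                                           (trans (cong (j ≡ᵇ_) written) (≡ᵇ-refl j)) ⟩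
      cFormula ℓ β (cTab ℓ β n) j    ≡⟨ cFormula-local (cTab ℓ β n) (c ℓ β) j (λ i p _ → sym (final i p)) ⟩
      cFormula ℓ β (c ℓ β) j         ∎
      where
      open ≡-Reasoning
      n = ℓ ∸ suc j
      ℓ-j : ℓ ∸ j ≡ suc n
      ℓ-j = ℕP.+-∸-assoc 1 j<ℓ
      j+steps≡ℓ : j ℕ.+ suc n ≡ ℓ
      j+steps≡ℓ = trans (cong (j ℕ.+_) (sym ℓ-j)) (ℕP.m+[n∸m]≡n (ℕP.<⇒≤ j<ℓ))
      written : ℓ ∸ suc n ≡ j
      written = trans (cong (ℓ ∸_) (sym ℓ-j)) (ℕP.m∸[m∸n]≡n (ℕP.<⇒≤ j<ℓ))
      final : ∀ i → suc j ℕ.≤ i → cTab ℓ β ℓ i ≡ cTab ℓ β n i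
      final i p = trans (cong (λ z → cTab ℓ β z i) (sym (ℕP.m∸n+n≡m (ℕP.m∸n≤m ℓ (suc j)))))
        (cTab-stable n (ℓ ∸ n) i (subst (ℕ._≤ i) (sym (ℕP.m∸[m∸n]≡n j<ℓ)) p) (ℕP.≤-reflexive (ℕP.m∸n+n≡m (ℕP.m∸n≤m ℓ (suc j)))))

-- Ranking inside the lexicographically ordered lists of Defs:
-- B≥ t m lists the non-decreasing words of length m whose letters are all
-- ≥ a_{t+1}; rank t w is the position of w in B≥ t |w|.
module Ranking where

  open import Defs
  open import Data.Bool using (Bool; true; false; if_then_else_; _∧_)
  open import Data.Nat as ℕ using (ℕ; zero; suc; _+_; z≤n; s≤s; _≤ᵇ_; _<ᵇ_)
  import Data.Nat.Properties as ℕP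
  open import Data.Fin as Fin using (Fin; toℕ)
  open import Data.List using (List; []; _∷_; map; concatMap; allFin; filterᵇ; length; _++_; tabulate)
  open import Data.List.Relation.Unary.All as All using (All; []; _∷_)
  import Data.List.Relation.Unary.All.Properties as AllP
  open import Data.List.Relation.Unary.Any using (here; there)
  open import Data.List.Membership.Propositional using (_∈_)
  open import Data.List.Membership.Propositional.Properties using (∈-allFin)
  open import Data.Maybe using (just)
  import Data.Maybe as Maybe
  open import Data.Product using (Σ; _×_; _,_)
  open import Data.Sum using (_⊎_; inj₁; inj₂)
  open import Data.Unit using (⊤; tt)
  open import Function using (_∘_; id)
  open import Relation.Binary.PropositionalEquality
  open Booleans

  filterᵇ-cons : ∀ {A : Set} (p : A → Bool) x xs → filterᵇ p (x ∷ xs) ≡ (if p x then x ∷ filterᵇ p xs else filterᵇ p xs)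
  filterᵇ-cons p x xs with p x
  ... | true  = refl
  ... | false = refl

  filterᵇ-++ : ∀ {A : Set} (p : A → Bool) xs ys → filterᵇ p (xs ++ ys) ≡ filterᵇ p xs ++ filterᵇ p ys
  filterᵇ-++ p []       ys = refl
  filterᵇ-++ p (x ∷ xs) ys with p x
  ... | true  = cong (x ∷_) (filterᵇ-++ p xs ys)
  ... | false = filterᵇ-++ p xs ys

  filterᵇ-concatMap : ∀ {A B : Set} (p : B → Bool) (f : A → List B) xs →
    filterᵇ p (concatMap f xs) ≡ concatMap (filterᵇ p ∘ f) xs
  filterᵇ-concatMap p f []       = refl
  filterᵇ-concatMap p f (x ∷ xs) = trans (filterᵇ-++ p (f x) (concatMap f xs)) (cong (filterᵇ p (f x) ++_) (filterᵇ-concatMap p f xs))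

  filterᵇ-cong : ∀ {A : Set} (p q : A → Bool) xs → (∀ x → p x ≡ q x) → filterᵇ p xs ≡ filterᵇ q xs
  filterᵇ-cong p q []       e = refl
  filterᵇ-cong p q (x ∷ xs) e rewrite filterᵇ-cons p x xs | filterᵇ-cons q x xs | e x =
    cong (λ z → if q x then x ∷ z else z) (filterᵇ-cong p q xs e)

  concatMap-cong : ∀ {A B : Set} (f g : A → List B) xs → (∀ x → f x ≡ g x) → concatMap f xs ≡ concatMap g xs
  concatMap-cong f g []       e = refl
  concatMap-cong f g (x ∷ xs) e = cong₂ _++_ (e x) (concatMap-cong f g xs e)

  nth-++ˡ : ∀ {A : Set} (xs ys : List A) n → n ℕ.< length xs → nth (xs ++ ys) n ≡ nth xs n
  nth-++ˡ (x ∷ xs) ys zero    _       = refl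
  nth-++ˡ (x ∷ xs) ys (suc n) (s≤s p) = nth-++ˡ xs ys n p

  nth-++ʳ : ∀ {A : Set} (xs ys : List A) n → nth (xs ++ ys) (length xs + n) ≡ nth ys n
  nth-++ʳ []       ys n = refl
  nth-++ʳ (x ∷ xs) ys n = nth-++ʳ xs ys n

  nth-< : ∀ {A : Set} (xs : List A) n {v} → nth xs n ≡ just v → n ℕ.< length xs
  nth-< (x ∷ xs) zero    e = s≤s z≤n
  nth-< (x ∷ xs) (suc n) e = s≤s (nth-< xs n e)

  nth-++⁻ : ∀ {A : Set} (xs ys : List A) n {v} → nth (xs ++ ys) n ≡ just v →
    (nth xs n ≡ just v) ⊎ Σ ℕ (λ n' → (n ≡ length xs + n') × (nth ys n' ≡ just v))
  nth-++⁻ []       ys n       e = inj₂ (n , refl , e)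
  nth-++⁻ (x ∷ xs) ys zero    e = inj₁ e
  nth-++⁻ (x ∷ xs) ys (suc n) e with nth-++⁻ xs ys n e
  ... | inj₁ e'             = inj₁ e'
  ... | inj₂ (n' , eq , e') = inj₂ (n' , cong suc eq , e')

  nth-map : ∀ {A B : Set} (f : A → B) xs n → nth (map f xs) n ≡ Maybe.map f (nth xs n)
  nth-map f []       n       = refl
  nth-map f (x ∷ xs) zero    = refl
  nth-map f (x ∷ xs) (suc n) = nth-map f xs n

  module Alphabet (ℓ : ℕ) where
    W = Word ℓ

    Increasing : List (Fin ℓ) → Set
    Increasing []       = ⊤
    Increasing (y ∷ ys) = All (λ z → toℕ y ℕ.< toℕ z) ys × Increasing ys

    increasing-tabulate : ∀ n k (g : Fin n → Fin ℓ) → (∀ i → toℕ (g i) ≡ k + toℕ i) → Increasing (tabulate g)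
    increasing-tabulate zero    k g e = tt
    increasing-tabulate (suc n) k g e =
      AllP.tabulate⁺ (λ i → subst₂ ℕ._<_ (sym (e Fin.zero)) (sym (e (Fin.suc i))) (ℕP.+-monoʳ-< k (s≤s z≤n))) ,
      increasing-tabulate n (suc k) (g ∘ Fin.suc) (λ i → trans (e (Fin.suc i)) (ℕP.+-suc k (toℕ i)))

    increasing-allFin : Increasing (allFin ℓ)
    increasing-allFin = increasing-tabulate ℓ 0 id (λ i → refl)

    -- Positions in a concatenation F y₁ ++ F y₂ ++ ... over an increasing list of letters:
    -- the block of x starts at offset xs x, the total length of the blocks of letters below x.
    module Blocks (F : Fin ℓ → List W) where
      offset : List (Fin ℓ) → Fin ℓ → ℕ
      offset []       x = 0
      offset (y ∷ ys) x = (if toℕ y <ᵇ toℕ x then length (F y) else 0) + offset ys x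

      offset-above : ∀ ys y → All (λ z → toℕ y ℕ.< toℕ z) ys → offset ys y ≡ 0
      offset-above []       y a       = refl
      offset-above (z ∷ zs) y (p ∷ a) rewrite <ᵇ-false {toℕ z} {toℕ y} (ℕP.<⇒≤ p) = offset-above zs y a

      nth-block : ∀ xs x r v → x ∈ xs → Increasing xs → nth (F x) r ≡ just v →
        nth (concatMap F xs) (offset xs x + r) ≡ just v
      nth-block (y ∷ ys) .y r v (here refl) (a , s) e
        rewrite <ᵇ-false {toℕ y} {toℕ y} ℕP.≤-refl | offset-above ys y a =
        trans (nth-++ˡ (F y) (concatMap F ys) r (nth-< (F y) r e)) e
      nth-block (y ∷ ys) x r v (there p) (a , s) e rewrite <ᵇ-true (All.lookup a p) =
        trans (cong (nth (F y ++ concatMap F ys)) (ℕP.+-assoc (length (F y)) (offset ys x) r))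
          (trans (nth-++ʳ (F y) (concatMap F ys) (offset ys x + r)) (nth-block ys x r v p s e))

      nth-block⁻ : ∀ xs n v → Increasing xs → nth (concatMap F xs) n ≡ just v →
        Σ (Fin ℓ) λ x → (x ∈ xs) × Σ ℕ λ r → (n ≡ offset xs x + r) × (nth (F x) r ≡ just v)
      nth-block⁻ (y ∷ ys) n v (a , s) e with nth-++⁻ (F y) (concatMap F ys) n e
      ... | inj₁ e' = y , here refl , n , first , e'
        where
        first : n ≡ offset (y ∷ ys) y + n
        first rewrite <ᵇ-false {toℕ y} {toℕ y} ℕP.≤-refl | offset-above ys y a = refl
      ... | inj₂ (n' , eq , e') with nth-block⁻ ys n' v s e'
      ...   | x , p , r , eq' , e'' = x , there p , r , later , e''
        where
        later : n ≡ offset (y ∷ ys) x + r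
        later rewrite <ᵇ-true (All.lookup a p) =
          trans eq (trans (cong (length (F y) +_) eq') (sym (ℕP.+-assoc (length (F y)) (offset ys x) r)))

    nondecᵇ : ℕ → W → Bool
    nondecᵇ t []      = true
    nondecᵇ t (x ∷ w) = (t ≤ᵇ toℕ x) ∧ nondecᵇ (toℕ x) w

    B≥ : ℕ → ℕ → List W
    B≥ t m = filterᵇ (nondecᵇ t) (allWords ℓ m)

    branch : ℕ → ℕ → Fin ℓ → List W
    branch t m x = if t ≤ᵇ toℕ x then map (x ∷_) (B≥ (toℕ x) m) else []

    filter-prefixed : ∀ t x ws → filterᵇ (nondecᵇ t) (map (x ∷_) ws)
                                ≡ (if t ≤ᵇ toℕ x then map (x ∷_) (filterᵇ (nondecᵇ (toℕ x)) ws) else [])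
    filter-prefixed t x [] with t ≤ᵇ toℕ x
    ... | true  = refl
    ... | false = refl
    filter-prefixed t x (w ∷ ws)
      rewrite filterᵇ-cons (nondecᵇ t) (x ∷ w) (map (x ∷_) ws) | filterᵇ-cons (nondecᵇ (toℕ x)) w ws
            | filter-prefixed t x ws with t ≤ᵇ toℕ x
    ... | false = refl
    ... | true with nondecᵇ (toℕ x) w
    ...   | true  = refl
    ...   | false = refl

    B≥-suc : ∀ t m → B≥ t (suc m) ≡ concatMap (branch t m) (allFin ℓ)
    B≥-suc t m = trans (filterᵇ-concatMap (nondecᵇ t) (λ x → map (x ∷_) (allWords ℓ m)) (allFin ℓ))
                       (concatMap-cong _ _ (allFin ℓ) (λ x → filter-prefixed t x (allWords ℓ m)))

    rank : ℕ → W → ℕ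
    rank t []      = 0
    rank t (x ∷ w) = Blocks.offset (branch t (length w)) (allFin ℓ) x + rank (toℕ x) w

    rank-correct : ∀ t w → nondecᵇ t w ≡ true → nth (B≥ t (length w)) (rank t w) ≡ just w
    rank-correct t []      e = refl
    rank-correct t (x ∷ w) e = trans (cong (λ z → nth z (rank t (x ∷ w))) (B≥-suc t (length w)))
      (Blocks.nth-block (branch t (length w)) (allFin ℓ) x (rank (toℕ x) w) (x ∷ w) (∈-allFin x) increasing-allFin inBranch)
      where
      inBranch : nth (branch t (length w) x) (rank (toℕ x) w) ≡ just (x ∷ w)
      inBranch rewrite ∧-true-l {t ≤ᵇ toℕ x} e =
        trans (nth-map (x ∷_) (B≥ (toℕ x) (length w)) (rank (toℕ x) w))
              (cong (Maybe.map (x ∷_)) (rank-correct (toℕ x) w (∧-true-r {t ≤ᵇ toℕ x} e)))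

    rank-unique : ∀ t m n w → nth (B≥ t m) n ≡ just w → (n ≡ rank t w) × (length w ≡ m)
    rank-unique t zero    zero    .[] refl = refl , refl
    rank-unique t (suc m) n       w   e
      with Blocks.nth-block⁻ (branch t m) (allFin ℓ) n w increasing-allFin (trans (cong (λ z → nth z n) (sym (B≥-suc t m))) e)
    ... | x , _ , r , eq , e' with t ≤ᵇ toℕ x
    ...   | true with nth (B≥ (toℕ x) m) r in found | trans (sym (nth-map (x ∷_) (B≥ (toℕ x) m) r)) e'
    ...     | just w' | refl with rank-unique (toℕ x) m r w' found
    ...       | eqr , refl = trans eq (cong₂ _+_ refl eqr) , refl

-- Counting words: count t m = |B≥ t m|, and the position of a word w in the
-- genealogical order of B≥ t is  Σ_u cumCount (t+u) (letters≥ (t+u) w),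
-- where cumCount s n counts the words of B≥ s shorter than n and
-- letters≥ s w counts the letters of w that are ≥ a_{s+1}.
module WordCounts where

  open import Defs
  open import Data.Bool using (true; false; if_then_else_)
  open import Data.Nat as ℕ using (ℕ; zero; suc; _+_; z≤n; s≤s; _≤ᵇ_; _<ᵇ_; _≡ᵇ_)
  import Data.Nat.Properties as ℕP
  open import Data.Nat.ListAction using (sum)
  open import Data.Fin as Fin using (Fin; toℕ)
  import Data.Fin.Properties as FinP
  open import Data.List using (List; []; _∷_; map; concatMap; allFin; length; tabulate)
  import Data.List.Properties as LP

  open import Function using (_∘_; id)
  open import Relation.Binary.PropositionalEquality
  open import Relation.Binary.Definitions using (tri<; tri≈; tri>)
  open import Relation.Nullary using (yes; no)
  open import Data.Empty using (⊥-elim)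
  open Booleans
  open FiniteSums using (module ℕΣ)
  open ℕΣ
  open Ranking

  sum-map-cong : ∀ {A : Set} (f g : A → ℕ) xs → (∀ x → f x ≡ g x) → sum (map f xs) ≡ sum (map g xs)
  sum-map-cong f g []       e = refl
  sum-map-cong f g (x ∷ xs) e = cong₂ _+_ (e x) (sum-map-cong f g xs e)

  sum-allFin : ∀ ℓ (f : Fin ℓ → ℕ) (h : ℕ → ℕ) → (∀ x → f x ≡ h (toℕ x)) → sum (map f (allFin ℓ)) ≡ sumN ℓ h
  sum-allFin ℓ f h e = trans (sum-map-cong f (h ∘ toℕ) (allFin ℓ) e) (go ℓ 0 id (λ _ → refl))
    where
    go : ∀ n k (g : Fin n → Fin ℓ) → (∀ i → toℕ (g i) ≡ k + toℕ i) → sum (map (h ∘ toℕ) (tabulate g)) ≡ sumN n (λ i → h (k + i))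
    go zero    k g e = refl
    go (suc n) k g e = cong₂ _+_ (cong h (e Fin.zero))
      (trans (go n (suc k) (g ∘ Fin.suc) (λ i → trans (e (Fin.suc i)) (ℕP.+-suc k (toℕ i))))
             (sumN-cong n (λ i _ → cong h (sym (ℕP.+-suc k i)))))

  length-concatMap : ∀ {A B : Set} (f : A → List B) xs → length (concatMap f xs) ≡ sum (map (length ∘ f) xs)
  length-concatMap f []       = refl
  length-concatMap f (x ∷ xs) = trans (LP.length-++ (f x)) (cong (length (f x) +_) (length-concatMap f xs))

  sum-from-split : ∀ ℓ t (g : ℕ → ℕ) → t ℕ.< ℓ →
    sumN ℓ (λ i → if t ≤ᵇ i then g i else 0) ≡ g t + sumN ℓ (λ i → if suc t ≤ᵇ i then g i else 0)
  sum-from-split ℓ t g t<ℓ = begin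
    sumN ℓ (λ i → if t ≤ᵇ i then g i else 0)                                    ≡⟨ sumN-cong ℓ (λ i _ → split i) ⟩
    sumN ℓ (λ i → (if i ≡ᵇ t then g i else 0) + (if suc t ≤ᵇ i then g i else 0)) ≡⟨ sumN-∙ ℓ _ _ ⟩
    sumN ℓ (λ i → if i ≡ᵇ t then g i else 0) + sumN ℓ (λ i → if suc t ≤ᵇ i then g i else 0)
      ≡⟨ cong (_+ sumN ℓ (λ i → if suc t ≤ᵇ i then g i else 0))
           (trans (sumN-single ℓ t _ t<ℓ (λ i _ ne → cong (λ b → if b then g i else 0) (≡ᵇ-≢ ne)))
                  (cong (λ b → if b then g t else 0) (≡ᵇ-refl t))) ⟩
    g t + sumN ℓ (λ i → if suc t ≤ᵇ i then g i else 0)                           ∎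
    where
    open ≡-Reasoning
    split : ∀ i → (if t ≤ᵇ i then g i else 0) ≡ (if i ≡ᵇ t then g i else 0) + (if suc t ≤ᵇ i then g i else 0)
    split i with ℕP.<-cmp i t
    ... | tri< a _ _    rewrite ≤ᵇ-false {t} {i} a | ≡ᵇ-≢ (ℕP.<⇒≢ a) | ≤ᵇ-false {suc t} {i} (ℕP.m<n⇒m<1+n a) = refl
    ... | tri≈ _ refl _ rewrite ≤ᵇ-true {i} {i} ℕP.≤-refl | ≡ᵇ-refl i | ≤ᵇ-false {suc i} {i} (ℕP.n<1+n i) = sym (ℕP.+-identityʳ _)
    ... | tri> _ _ c    rewrite ≤ᵇ-true {t} {i} (ℕP.<⇒≤ c) | ≡ᵇ-≢ (ℕP.<⇒≢ c ∘ sym) | ≤ᵇ-true {suc t} {i} c = refl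

  module Counting (ℓ : ℕ) where
    open Alphabet ℓ

    count : ℕ → ℕ → ℕ
    count t zero    = 1
    count t (suc m) = sumN ℓ (λ i → if t ≤ᵇ i then count i m else 0)

    -- Words of B≥ t (m+1) whose first letter is below a_{j+1}.
    countBelow : ℕ → ℕ → ℕ → ℕ
    countBelow t m j = sumN ℓ (λ i → if i <ᵇ j then (if t ≤ᵇ i then count i m else 0) else 0)

    cumCount : ℕ → ℕ → ℕ
    cumCount t zero    = 0
    cumCount t (suc n) = cumCount t n + count t n

    length-B≥ : ∀ t m → length (B≥ t m) ≡ count t m
    length-branch : ∀ t m x → length (branch t m x) ≡ (if t ≤ᵇ toℕ x then count (toℕ x) m else 0)
    length-branch t m x with t ≤ᵇ toℕ x
    ... | true  = trans (LP.length-map (x ∷_) (B≥ (toℕ x) m)) (length-B≥ (toℕ x) m)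
    ... | false = refl
    length-B≥ t zero    = refl
    length-B≥ t (suc m) = trans (cong length (B≥-suc t m)) (trans (length-concatMap (branch t m) (allFin ℓ))
      (sum-allFin ℓ (length ∘ branch t m) (λ i → if t ≤ᵇ i then count i m else 0) (length-branch t m)))

    rank-cons : ∀ t x w → rank t (x ∷ w) ≡ countBelow t (length w) (toℕ x) + rank (toℕ x) w
    rank-cons t x w = cong (_+ rank (toℕ x) w) (trans (offset-sum (allFin ℓ))
      (sum-allFin ℓ _ _ (λ y → cong (λ z → if toℕ y <ᵇ toℕ x then z else 0) (length-branch t (length w) y))))
      where
      F = branch t (length w)
      offset-sum : ∀ xs → Blocks.offset F xs x ≡ sum (map (λ y → if toℕ y <ᵇ toℕ x then length (F y) else 0) xs)
      offset-sum []       = refl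
      offset-sum (y ∷ ys) = cong ((if toℕ y <ᵇ toℕ x then length (F y) else 0) +_) (offset-sum ys)

    countBelow-self : ∀ t m → countBelow t m t ≡ 0
    countBelow-self t m = sumN-0 ℓ (λ i _ → vanish i)
      where
      vanish : ∀ i → (if i <ᵇ t then (if t ≤ᵇ i then count i m else 0) else 0) ≡ 0
      vanish i with ℕP.<-cmp i t
      ... | tri< a _ _ rewrite <ᵇ-true a | ≤ᵇ-false {t} {i} a = refl
      ... | tri≈ _ b _ rewrite <ᵇ-false {i} {t} (ℕP.≤-reflexive (sym b)) = refl
      ... | tri> _ _ c rewrite <ᵇ-false {i} {t} (ℕP.<⇒≤ c) = refl

    -- Words of length m over letters ≥ a_{t+1} correspond to words of length < m+1 over letters ≥ a_{t+2},
    -- by deleting the leading letters a_{t+1}.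
    count-cumCount : ∀ t m → t ℕ.< ℓ → count t m ≡ cumCount (suc t) (suc m)
    count-cumCount t zero    _   = refl
    count-cumCount t (suc m) t<ℓ =
      trans (sum-from-split ℓ t (λ i → count i m) t<ℓ) (cong (_+ count (suc t) (suc m)) (count-cumCount t m t<ℓ))

    countBelow-split : ∀ t m j → t ℕ.< j → t ℕ.< ℓ → countBelow t m j ≡ count t m + countBelow (suc t) m j
    countBelow-split t m j t<j t<ℓ = trans (sumN-cong ℓ (λ i _ → swap t i))
      (trans (sum-from-split ℓ t (λ i → if i <ᵇ j then count i m else 0) t<ℓ)
        (cong₂ _+_ (cong (λ b → if b then count t m else 0) (<ᵇ-true t<j)) (sumN-cong ℓ (λ i _ → sym (swap (suc t) i)))))
      where
      swap : ∀ s i → (if i <ᵇ j then (if s ≤ᵇ i then count i m else 0) else 0)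
                   ≡ (if s ≤ᵇ i then (if i <ᵇ j then count i m else 0) else 0)
      swap s i with i <ᵇ j | s ≤ᵇ i
      ... | true  | true  = refl
      ... | true  | false = refl
      ... | false | true  = refl
      ... | false | false = refl

    rank-same : ∀ t x w → toℕ x ≡ t → rank t (x ∷ w) ≡ rank t w
    rank-same t x w refl = trans (rank-cons t x w) (cong (_+ rank t w) (countBelow-self t (length w)))

    rank-up : ∀ t w → nondecᵇ (suc t) w ≡ true → t ℕ.< ℓ → rank t w ≡ cumCount (suc t) (length w) + rank (suc t) w
    rank-up t []      _ _   = refl
    rank-up t (x ∷ w) e t<ℓ = begin
      rank t (x ∷ w)                                                      ≡⟨ rank-cons t x w ⟩
      countBelow t (length w) (toℕ x) + rank (toℕ x) w
        ≡⟨ cong (_+ rank (toℕ x) w) (countBelow-split t (length w) (toℕ x) (≤ᵇ⇒≤ (∧-true-l {suc t ≤ᵇ toℕ x} e)) t<ℓ) ⟩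
      count t (length w) + countBelow (suc t) (length w) (toℕ x) + rank (toℕ x) w
        ≡⟨ cong (λ z → z + countBelow (suc t) (length w) (toℕ x) + rank (toℕ x) w) (count-cumCount t (length w) t<ℓ) ⟩
      cumCount (suc t) (suc (length w)) + countBelow (suc t) (length w) (toℕ x) + rank (toℕ x) w
        ≡⟨ ℕP.+-assoc (cumCount (suc t) (suc (length w))) _ _ ⟩
      cumCount (suc t) (suc (length w)) + (countBelow (suc t) (length w) (toℕ x) + rank (toℕ x) w)
        ≡⟨ cong (cumCount (suc t) (suc (length w)) +_) (sym (rank-cons (suc t) x w)) ⟩
      cumCount (suc t) (length (x ∷ w)) + rank (suc t) (x ∷ w) ∎
      where open ≡-Reasoning

    strip : ℕ → W → W
    strip t []      = []
    strip t (x ∷ w) = if toℕ x ≡ᵇ t then strip t w else x ∷ w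

    letters≥ : ℕ → W → ℕ
    letters≥ s []      = 0
    letters≥ s (x ∷ w) = (if s ≤ᵇ toℕ x then 1 else 0) + letters≥ s w

    nondec-mono : ∀ s t w → s ℕ.≤ t → nondecᵇ t w ≡ true → nondecᵇ s w ≡ true
    nondec-mono s t []      _  _ = refl
    nondec-mono s t (x ∷ w) le e rewrite ≤ᵇ-true {s} {toℕ x} (ℕP.≤-trans le (≤ᵇ⇒≤ (∧-true-l {t ≤ᵇ toℕ x} e))) =
      ∧-true-r {t ≤ᵇ toℕ x} e

    length-letters≥ : ∀ t w → nondecᵇ t w ≡ true → length w ≡ letters≥ t w
    length-letters≥ t []      _ = refl
    length-letters≥ t (x ∷ w) e rewrite ∧-true-l {t ≤ᵇ toℕ x} e =
      cong suc (length-letters≥ t w (nondec-mono t (toℕ x) w (≤ᵇ⇒≤ (∧-true-l {t ≤ᵇ toℕ x} e)) (∧-true-r {t ≤ᵇ toℕ x} e)))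

    record Stripped (t : ℕ) (w : W) : Set where
      field
        nondec    : nondecᵇ (suc t) (strip t w) ≡ true
        rank≡     : rank t w ≡ cumCount (suc t) (length (strip t w)) + rank (suc t) (strip t w)
        letters≡  : ∀ s → t ℕ.< s → letters≥ s (strip t w) ≡ letters≥ s w
        length≡   : length (strip t w) ≡ letters≥ (suc t) w

    stripped : ∀ t w → nondecᵇ t w ≡ true → t ℕ.< ℓ → Stripped t w
    stripped t []      e t<ℓ = record { nondec = refl ; rank≡ = refl ; letters≡ = λ _ _ → refl ; length≡ = refl }
    stripped t (x ∷ w) e t<ℓ with toℕ x ℕP.≟ t
    ... | yes x≡t = record
      { nondec   = subst (λ z → nondecᵇ (suc t) z ≡ true) (sym dropped) S.nondec
      ; rank≡    = trans (rank-same t x w x≡t) (trans S.rank≡ (cong (λ z → cumCount (suc t) (length z) + rank (suc t) z) (sym dropped)))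
      ; letters≡ = λ s t<s → trans (cong (letters≥ s) dropped)
                     (trans (S.letters≡ s t<s) (cong (_+ letters≥ s w) (sym (not-counted s (subst (ℕ._< s) (sym x≡t) t<s)))))
      ; length≡  = trans (cong length dropped)
                     (trans S.length≡ (cong (_+ letters≥ (suc t) w) (sym (not-counted (suc t) (ℕP.≤-reflexive (cong suc x≡t))))))
      }
      where
      not-counted : ∀ s → toℕ x ℕ.< s → (if s ≤ᵇ toℕ x then 1 else 0) ≡ 0
      not-counted s x<s = cong (λ b → if b then 1 else 0) (≤ᵇ-false {s} {toℕ x} x<s)
      dropped : strip t (x ∷ w) ≡ strip t w
      dropped = cong (λ b → if b then strip t w else x ∷ w) (trans (cong (toℕ x ≡ᵇ_) (sym x≡t)) (≡ᵇ-refl (toℕ x)))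
      module S = Stripped (stripped t w (subst (λ z → nondecᵇ z w ≡ true) x≡t (∧-true-r {t ≤ᵇ toℕ x} e)) t<ℓ)
    ... | no x≢t = record
      { nondec   = subst (λ z → nondecᵇ (suc t) z ≡ true) (sym kept) nondec'
      ; rank≡    = trans (rank-up t (x ∷ w) nondec' t<ℓ) (cong (λ z → cumCount (suc t) (length z) + rank (suc t) z) (sym kept))
      ; letters≡ = λ s _ → cong (letters≥ s) kept
      ; length≡  = trans (cong length kept) (length-letters≥ (suc t) (x ∷ w) nondec')
      }
      where
      kept : strip t (x ∷ w) ≡ x ∷ w
      kept = cong (λ b → if b then strip t w else x ∷ w) (≡ᵇ-≢ x≢t)
      nondec' : nondecᵇ (suc t) (x ∷ w) ≡ true
      nondec' rewrite ≤ᵇ-true {suc t} {toℕ x} (ℕP.≤∧≢⇒< (≤ᵇ⇒≤ (∧-true-l {t ≤ᵇ toℕ x} e)) (x≢t ∘ sym)) = ∧-true-r {t ≤ᵇ toℕ x} e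

    -- Position of w among all words of B≥ t in genealogical order.
    index : ℕ → W → ℕ
    index t w = cumCount t (length w) + rank t w

    -- Stripping the letters a_{t+1}, a_{t+2}, ... one value of t at a time gives the index as a sum.
    index-formula : ∀ j t w → t + j ≡ ℓ → nondecᵇ t w ≡ true → index t w ≡ sumN j (λ u → cumCount (t + u) (letters≥ (t + u) w))
    index-formula zero    t []      eq e = refl
    index-formula zero    t (x ∷ w) eq e = ⊥-elim (ℕP.<⇒≱ (FinP.toℕ<n x)
      (subst (ℕ._≤ toℕ x) (trans (sym (ℕP.+-identityʳ t)) eq) (≤ᵇ⇒≤ (∧-true-l {t ≤ᵇ toℕ x} e))))
    index-formula (suc j) t w eq e = begin
      cumCount t (length w) + rank t w
        ≡⟨ cong₂ _+_ (cong (cumCount t) (length-letters≥ t w e)) S.rank≡ ⟩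
      cumCount t (letters≥ t w) + index (suc t) s
        ≡⟨ cong (cumCount t (letters≥ t w) +_) (index-formula j (suc t) s (trans (sym (ℕP.+-suc t j)) eq) S.nondec) ⟩
      cumCount t (letters≥ t w) + sumN j (λ u → cumCount (suc t + u) (letters≥ (suc t + u) s))
        ≡⟨ cong₂ _+_ (cong (λ z → cumCount z (letters≥ z w)) (sym (ℕP.+-identityʳ t)))
             (sumN-cong j (λ u _ → trans (cong (cumCount (suc t + u)) (S.letters≡ (suc t + u) (s≤s (ℕP.m≤m+n t u))))
                                         (cong (λ z → cumCount z (letters≥ z w)) (sym (ℕP.+-suc t u))))) ⟩
      cumCount (t + 0) (letters≥ (t + 0) w) + sumN j (λ u → cumCount (t + suc u) (letters≥ (t + suc u) w)) ∎
      where
      open ≡-Reasoning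
      t<ℓ : t ℕ.< ℓ
      t<ℓ = subst (t ℕ.<_) eq (ℕP.m<m+n t (s≤s z≤n))
      module S = Stripped (stripped t w e t<ℓ)
      s = strip t w

module Valuation where

  open import Defs
  open import Data.Bool using (true; false; if_then_else_; _∧_)
  open import Data.Nat as ℕ using (ℕ; zero; suc; _∸_; _+_; z≤n; s≤s; _≤ᵇ_; _<ᵇ_)
  import Data.Nat.Properties as ℕP
  open import Data.Fin as Fin using (Fin; toℕ)
  open import Data.List using ([]; _∷_; length; replicate)
  import Data.List.Properties as LP
  open import Data.Maybe using (just)
  open import Data.Product using (Σ; _×_; _,_)
  open import Data.Rational as ℚ using (ℚ; 1ℚ)
  import Data.Rational.Properties as ℚP
  open import Relation.Binary.PropositionalEquality
  open Booleans
  open Rationals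
  open FiniteSums
  open ℚΣ
  open Polynomials using (pascal; binom-one; binom-overflow)
  open Ranking
  open WordCounts

  module Numeration (ℓ : ℕ) where
    open Alphabet ℓ
    open Counting ℓ

    inB-nondec : ∀ w → inBᵇ w ≡ nondecᵇ 0 w
    inB-nondec []      = refl
    inB-nondec (x ∷ w) = cons x w
      where
      cons : ∀ x w → inBᵇ (x ∷ w) ≡ nondecᵇ (toℕ x) w
      cons x []      = refl
      cons x (y ∷ w) = cong ((toℕ x ≤ᵇ toℕ y) ∧_) (cons y w)

    wordsB≡B≥0 : ∀ m → wordsB ℓ m ≡ B≥ 0 m
    wordsB≡B≥0 m = filterᵇ-cong inBᵇ (nondecᵇ 0) (allWords ℓ m) inB-nondec

    cumFrom : ℕ → ℕ → ℕ
    cumFrom m zero    = 0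
    cumFrom m (suc k) = length (wordsB ℓ m) + cumFrom (suc m) k

    repAux-skip : ∀ fuel m k r {w} → k ℕ.< fuel → nth (wordsB ℓ (k + m)) r ≡ just w → repAux ℓ fuel m (cumFrom m k + r) ≡ just w
    repAux-skip (suc f) m zero    r lt      e rewrite <ᵇ-true (nth-< (wordsB ℓ m) r e) = e
    repAux-skip (suc f) m (suc k) r {w} (s≤s lt) e = begin
      repAux ℓ (suc f) m (L + cumFrom (suc m) k + r)                ≡⟨ cong (repAux ℓ (suc f) m) (ℕP.+-assoc L (cumFrom (suc m) k) r) ⟩
      repAux ℓ (suc f) m (L + (cumFrom (suc m) k + r))
        ≡⟨ cong (λ b → if b then nth (wordsB ℓ m) (L + (cumFrom (suc m) k + r)) else repAux ℓ f (suc m) (L + (cumFrom (suc m) k + r) ∸ L))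
                (<ᵇ-false (ℕP.m≤m+n L _)) ⟩
      repAux ℓ f (suc m) (L + (cumFrom (suc m) k + r) ∸ L)          ≡⟨ cong (repAux ℓ f (suc m)) (ℕP.m+n∸m≡n L _) ⟩
      repAux ℓ f (suc m) (cumFrom (suc m) k + r)
        ≡⟨ repAux-skip f (suc m) k r lt (subst (λ z → nth (wordsB ℓ z) r ≡ just w) (sym (ℕP.+-suc k m)) e) ⟩
      just w ∎
      where
      open ≡-Reasoning
      L = length (wordsB ℓ m)

    repAux-found : ∀ fuel m n w → repAux ℓ fuel m n ≡ just w →
      Σ ℕ λ k → Σ ℕ λ r → (n ≡ cumFrom m k + r) × (nth (wordsB ℓ (k + m)) r ≡ just w)
    repAux-found (suc f) m n w e with n <ᵇ length (wordsB ℓ m) in fits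
    ... | true  = 0 , n , refl , e
    ... | false with repAux-found f (suc m) (n ∸ length (wordsB ℓ m)) w e
    ...   | k , r , eq , e' = suc k , r , eq' , subst (λ z → nth (wordsB ℓ z) r ≡ just w) (ℕP.+-suc k m) e'
      where
      L≤n : length (wordsB ℓ m) ℕ.≤ n
      L≤n = ℕP.≮⇒≥ (λ lt → false≢true (trans (sym fits) (<ᵇ-true lt)))
        where
        false≢true : false ≢ true
        false≢true ()
      eq' : n ≡ length (wordsB ℓ m) + cumFrom (suc m) k + r
      eq' = trans (sym (ℕP.m+[n∸m]≡n L≤n)) (trans (cong (length (wordsB ℓ m) +_) eq) (sym (ℕP.+-assoc (length (wordsB ℓ m)) _ r)))

    nondec-replicate : ∀ t x m → t ℕ.≤ toℕ x → nondecᵇ t (replicate m x) ≡ true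
    nondec-replicate t x zero    le = refl
    nondec-replicate t x (suc m) le rewrite ≤ᵇ-true le = nondec-replicate (toℕ x) x m ℕP.≤-refl

    -- val_ℓ, for non-decreasing words.
    val : W → ℕ
    val w = cumFrom 0 (length w) + rank 0 w

    -- B_ℓ has a word of every length when ℓ ≥ 1, so rep needs at most n+1 rounds.
    wordsB-nonempty : 1 ℕ.≤ ℓ → ∀ m → 1 ℕ.≤ length (wordsB ℓ m)
    wordsB-nonempty hℓ m = subst (λ z → 1 ℕ.≤ length z) (sym (wordsB≡B≥0 m))
      (ℕP.≤-trans (s≤s z≤n) (subst (λ z → rank 0 w ℕ.< length (B≥ 0 z)) (LP.length-replicate m)
        (nth-< (B≥ 0 (length w)) (rank 0 w) (rank-correct 0 w (nondec-replicate 0 x m z≤n)))))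
      where
      x = Fin.fromℕ< hℓ
      w = replicate m x

    cumFrom-≥ : 1 ℕ.≤ ℓ → ∀ m k → k ℕ.≤ cumFrom m k
    cumFrom-≥ hℓ m zero    = z≤n
    cumFrom-≥ hℓ m (suc k) = ℕP.+-mono-≤ (wordsB-nonempty hℓ m) (cumFrom-≥ hℓ (suc m) k)

    rep-val : 1 ℕ.≤ ℓ → ∀ w → nondecᵇ 0 w ≡ true → rep ℓ (val w) ≡ just w
    rep-val hℓ w e = repAux-skip (suc (val w)) 0 (length w) (rank 0 w)
      (s≤s (ℕP.≤-trans (cumFrom-≥ hℓ 0 (length w)) (ℕP.m≤m+n _ _)))
      (subst (λ z → nth z (rank 0 w) ≡ just w) (sym (trans (cong (wordsB ℓ) (ℕP.+-identityʳ (length w))) (wordsB≡B≥0 (length w))))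
        (rank-correct 0 w e))

    val-rep : ∀ n w → rep ℓ n ≡ just w → n ≡ val w
    val-rep n w e with repAux-found (suc n) 0 n w e
    ... | k , r , eq , e' with rank-unique 0 (k + 0) r w (subst (λ z → nth z r ≡ just w) (wordsB≡B≥0 (k + 0)) e')
    ...   | eqr , eql = trans eq (cong₂ _+_ (cong (cumFrom 0) (trans (sym (ℕP.+-identityʳ k)) (sym eql))) eqr)

    cumCount-cumFrom : ∀ m k → cumCount 0 m + cumFrom m k ≡ cumCount 0 (k + m)
    cumCount-cumFrom m zero    = ℕP.+-identityʳ _
    cumCount-cumFrom m (suc k) = trans (sym (ℕP.+-assoc (cumCount 0 m) (length (wordsB ℓ m)) _))
      (trans (cong (λ z → cumCount 0 m + z + cumFrom (suc m) k) (trans (cong length (wordsB≡B≥0 m)) (length-B≥ 0 m)))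
        (trans (cumCount-cumFrom (suc m) k) (cong (cumCount 0) (ℕP.+-suc k m))))

    val-formula : ∀ w → nondecᵇ 0 w ≡ true → val w ≡ ℕΣ.sumN ℓ (λ u → cumCount u (letters≥ u w))
    val-formula w e = trans (cong (_+ rank 0 w) (trans (cumCount-cumFrom 0 (length w)) (cong (cumCount 0) (ℕP.+-identityʳ (length w)))))
      (index-formula ℓ 0 w refl e)

    -- cumCount (ℓ-1-k) n = binom(n + k, k+1): stars and bars, via Pascal's rule.
    count-top : ∀ m → count ℓ (suc m) ≡ 0
    count-top m = ℕΣ.sumN-0 ℓ (λ i p → cong (λ b → if b then count i m else 0) (≤ᵇ-false p))

    -- Only the empty word has all letters ≥ a_{ℓ+1}.
    cumCount-top : ∀ n → cumCount ℓ (suc n) ≡ 1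
    cumCount-top zero    = refl
    cumCount-top (suc n) = cong₂ _+_ (cumCount-top n) (count-top n)

    -- The words over {a_ℓ} are a_ℓ^n, one of each length.
    cumCount-last : 1 ℕ.≤ ℓ → ∀ n → cumCount (ℓ ∸ 1) n ≡ n
    cumCount-last hℓ zero    = refl
    cumCount-last hℓ (suc n) = trans (cong₂ _+_ (cumCount-last hℓ n) (trans (count-cumCount (ℓ ∸ 1) n (ℕP.∸-monoʳ-< (s≤s z≤n) hℓ))
      (trans (cong (λ z → cumCount z (suc n)) (ℕP.m+[n∸m]≡n hℓ)) (cumCount-top n)))) (ℕP.+-comm n 1)

    cumCount-binom : ∀ k → k ℕ.< ℓ → ∀ n → ℕtoℚ (cumCount (ℓ ∸ suc k) n) ≡ binomQ (ℕtoℚ (n + k)) (suc k)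
    cumCount-binom zero    lt n = trans (cong ℕtoℚ (cumCount-last (ℕP.≤-trans (s≤s z≤n) lt) n))
                                   (sym (trans (binom-one (ℕtoℚ (n + 0))) (cong ℕtoℚ (ℕP.+-identityʳ n))))
    cumCount-binom (suc k) lt zero    = sym (binom-overflow k)
    cumCount-binom (suc k) lt (suc n) = begin
      ℕtoℚ (cumCount t n + count t n)                          ≡⟨ ℕtoℚ-+ (cumCount t n) (count t n) ⟩
      ℕtoℚ (cumCount t n) ℚ.+ ℕtoℚ (count t n)
        ≡⟨ cong₂ ℚ._+_ (cumCount-binom (suc k) lt n) (cong ℕtoℚ (trans (count-cumCount t n t<ℓ) (cong (λ z → cumCount z (suc n)) (sym t+1)))) ⟩
      binomQ (ℕtoℚ (n + suc k)) (suc (suc k)) ℚ.+ ℕtoℚ (cumCount (ℓ ∸ suc k) (suc n))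
        ≡⟨ cong (binomQ (ℕtoℚ (n + suc k)) (suc (suc k)) ℚ.+_) (trans (cumCount-binom k (ℕP.<-trans (ℕP.n<1+n k) lt) (suc n))
              (cong (λ z → binomQ (ℕtoℚ z) (suc k)) (sym (ℕP.+-suc n k)))) ⟩
      binomQ (ℕtoℚ (n + suc k)) (suc (suc k)) ℚ.+ binomQ (ℕtoℚ (n + suc k)) (suc k) ≡⟨ sym (pascal (ℕtoℚ (n + suc k)) (suc k)) ⟩
      binomQ (ℕtoℚ (n + suc k) ℚ.+ 1ℚ) (suc (suc k))
        ≡⟨ cong (λ z → binomQ z (suc (suc k))) (trans (ℚP.+-comm (ℕtoℚ (n + suc k)) 1ℚ) (sym (ℕtoℚ-suc (n + suc k)))) ⟩
      binomQ (ℕtoℚ (suc n + suc k)) (suc (suc k)) ∎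
      where
      open ≡-Reasoning
      t = ℓ ∸ suc (suc k)
      t+1 : ℓ ∸ suc k ≡ suc t
      t+1 = ℕP.+-∸-assoc 1 lt
      t<ℓ : t ℕ.< ℓ
      t<ℓ = ℕP.∸-monoʳ-< (s≤s z≤n) lt

    val-binomial : ∀ w → nondecᵇ 0 w ≡ true → ℕtoℚ (val w) ≡ sumN ℓ (λ k → binomQ (ℕtoℚ (letters≥ (ℓ ∸ suc k) w + k)) (suc k))
    val-binomial w e = begin
      ℕtoℚ (val w)                            ≡⟨ cong ℕtoℚ (trans (val-formula w e) (ℕΣ.sumN-reverse ℓ (λ u → cumCount u (n u)))) ⟩
      ℕtoℚ (ℕΣ.sumN ℓ (λ k → cumCount (ℓ ∸ suc k) (n (ℓ ∸ suc k)))) ≡⟨ ℕtoℚ-sumN ℓ (λ k → cumCount (ℓ ∸ suc k) (n (ℓ ∸ suc k))) ⟩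
      sumN ℓ (λ k → ℕtoℚ (cumCount (ℓ ∸ suc k) (n (ℓ ∸ suc k))))    ≡⟨ sumN-cong ℓ (λ k p → cumCount-binom k p (n (ℓ ∸ suc k))) ⟩
      sumN ℓ (λ k → binomQ (ℕtoℚ (n (ℓ ∸ suc k) + k)) (suc k)) ∎
      where
      open ≡-Reasoning
      n : ℕ → ℕ
      n u = letters≥ u w

module TargetWords where

  open import Defs
  open import Data.Bool using (true; false; if_then_else_)
  open import Data.Nat as ℕ using (ℕ; zero; suc; _∸_; z≤n; s≤s; _≤ᵇ_; _<ᵇ_)
  import Data.Nat.Properties as ℕP
  open import Data.Nat.ListAction using (sum)
  open import Data.Fin using (Fin; toℕ)
  open import Data.List using ([]; _∷_; replicate; _++_; concatMap; allFin; map)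
  open import Data.List.Relation.Unary.All as All using (All; []; _∷_)
  import Data.List.Relation.Unary.All.Properties as AllP
  open import Data.Integer as ℤ using (ℤ)
  import Data.Integer.Properties as ℤP
  open import Data.Integer.Solver using (module +-*-Solver)
  open import Data.Product using (_,_)
  open import Relation.Binary.PropositionalEquality
  open Booleans
  open FiniteSums using (module ℕΣ)
  open ℕΣ
  open Ranking
  open WordCounts

  module PowWords (ℓ : ℕ) where
    open Alphabet ℓ
    open Counting ℓ

    nondec-replicate-++ : ∀ t y n v → t ℕ.≤ toℕ y → nondecᵇ (toℕ y) v ≡ true → nondecᵇ t (replicate n y ++ v) ≡ true
    nondec-replicate-++ t y zero    v le e = nondec-mono t (toℕ y) v le e
    nondec-replicate-++ t y (suc n) v le e rewrite ≤ᵇ-true le = nondec-replicate-++ (toℕ y) y n v ℕP.≤-refl e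

    nondec-blocks : ∀ (e : Fin ℓ → ℕ) xs t → Increasing xs → All (λ z → t ℕ.≤ toℕ z) xs →
      nondecᵇ t (concatMap (λ y → replicate (e y) y) xs) ≡ true
    nondec-blocks e []       t _       _        = refl
    nondec-blocks e (y ∷ ys) t (a , s) (p ∷ ps) =
      nondec-replicate-++ t y (e y) _ p (nondec-blocks e ys (toℕ y) s (All.map ℕP.<⇒≤ a))

    nondec-powWord : ∀ e → nondecᵇ 0 (powWord ℓ e) ≡ true
    nondec-powWord e = nondec-blocks e (allFin ℓ) 0 increasing-allFin (AllP.tabulate⁺ (λ _ → z≤n))

    letters≥-++ : ∀ s u v → letters≥ s (u ++ v) ≡ letters≥ s u ℕ.+ letters≥ s v
    letters≥-++ s []      v = refl
    letters≥-++ s (x ∷ u) v =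
      trans (cong ((if s ≤ᵇ toℕ x then 1 else 0) ℕ.+_) (letters≥-++ s u v)) (sym (ℕP.+-assoc (if s ≤ᵇ toℕ x then 1 else 0) _ _))

    letters≥-replicate : ∀ s n y → letters≥ s (replicate n y) ≡ (if s ≤ᵇ toℕ y then n else 0)
    letters≥-replicate s zero    y with s ≤ᵇ toℕ y
    ... | true  = refl
    ... | false = refl
    letters≥-replicate s (suc n) y with s ≤ᵇ toℕ y in eq
    ... | true  = cong suc (trans (letters≥-replicate s n y) (cong (λ b → if b then n else 0) eq))
    ... | false = trans (letters≥-replicate s n y) (cong (λ b → if b then n else 0) eq)

    suffixSum : (ℕ → ℕ) → ℕ → ℕ
    suffixSum e s = sumN ℓ (λ i → if s ≤ᵇ i then e i else 0)

    letters≥-powWord : ∀ s (e : Fin ℓ → ℕ) (e' : ℕ → ℕ) → (∀ x → e x ≡ e' (toℕ x)) → letters≥ s (powWord ℓ e) ≡ suffixSum e' s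
    letters≥-powWord s e e' h = trans (blocks (allFin ℓ))
      (sum-allFin ℓ _ _ (λ x → cong (λ z → if s ≤ᵇ toℕ x then z else 0) (h x)))
      where
      blocks : ∀ xs → letters≥ s (concatMap (λ y → replicate (e y) y) xs) ≡ sum (map (λ y → if s ≤ᵇ toℕ y then e y else 0) xs)
      blocks []       = refl
      blocks (y ∷ ys) = trans (letters≥-++ s (replicate (e y) y) _) (cong₂ ℕ._+_ (letters≥-replicate s (e y) y) (blocks ys))

    suffixSum-top : ∀ e → suffixSum e ℓ ≡ 0
    suffixSum-top e = sumN-0 ℓ (λ i p → cong (λ b → if b then e i else 0) (≤ᵇ-false p))

    suffixSum-step : ∀ e s → s ℕ.< ℓ → suffixSum e s ≡ e s ℕ.+ suffixSum e (suc s)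
    suffixSum-step e s lt = sum-from-split ℓ s e lt

  targetExpℕ : ℕ → ℕ → (ℕ → ℤ) → ℕ → ℕ → ℕ
  targetExpℕ ℓ β d q t = if suc t <ᵇ ℓ then ℤ.∣ d (ℓ ∸ suc t) ℤ.- d (ℓ ∸ suc (suc t)) ∣ else ℤ.∣ ℤ.+ (β ℕ.* q) ℤ.+ d 0 ∣

  -- With d_0 ≤ ... ≤ d_{ℓ-1} and βq + d_0 ≥ 0, the target word has exactly βq + d_k letters ≥ a_{ℓ-k}:
  -- its suffix sums telescope (βq + d_0) + (d_1 - d_0) + ... + (d_k - d_{k-1}).
  module Target (L β : ℕ) (d : ℕ → ℤ) (q : ℕ)
     (nonneg : ℤ.0ℤ ℤ.≤ ℤ.+ (β ℕ.* q) ℤ.+ d 0)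
     (mono : (k : ℕ) → suc k ℕ.< suc L → d k ℤ.≤ d (suc k)) where
    ℓ = suc L
    open PowWords ℓ
    e = targetExpℕ ℓ β d q
    open +-*-Solver

    suffixSum-target : ∀ k → k ℕ.< ℓ → ℤ.+ (suffixSum e (ℓ ∸ suc k)) ≡ ℤ.+ (β ℕ.* q) ℤ.+ d k
    suffixSum-target zero lt = begin
      ℤ.+ (suffixSum e L)                 ≡⟨ cong ℤ.+_ (suffixSum-step e L (ℕP.n<1+n L)) ⟩
      ℤ.+ (e L ℕ.+ suffixSum e ℓ)         ≡⟨ cong (λ z → ℤ.+ (e L ℕ.+ z)) (suffixSum-top e) ⟩
      ℤ.+ (e L ℕ.+ 0)                     ≡⟨ cong ℤ.+_ (ℕP.+-identityʳ (e L)) ⟩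
      ℤ.+ (e L)                           ≡⟨ cong (λ b → ℤ.+ (if b then ℤ.∣ d (ℓ ∸ suc L) ℤ.- d (ℓ ∸ suc (suc L)) ∣ else ℤ.∣ ℤ.+ (β ℕ.* q) ℤ.+ d 0 ∣))
                                               (<ᵇ-false {ℓ} {ℓ} ℕP.≤-refl) ⟩
      ℤ.+ ℤ.∣ ℤ.+ (β ℕ.* q) ℤ.+ d 0 ∣     ≡⟨ ℤP.0≤i⇒+∣i∣≡i nonneg ⟩
      ℤ.+ (β ℕ.* q) ℤ.+ d 0               ∎
      where open ≡-Reasoning
    suffixSum-target (suc k) lt = begin
      ℤ.+ (suffixSum e s)                           ≡⟨ cong ℤ.+_ (suffixSum-step e s (ℕP.<-trans (ℕP.n<1+n s) s+1<ℓ)) ⟩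
      ℤ.+ (e s ℕ.+ suffixSum e (suc s))             ≡⟨ ℤP.pos-+ (e s) (suffixSum e (suc s)) ⟩
      ℤ.+ (e s) ℤ.+ ℤ.+ (suffixSum e (suc s))
        ≡⟨ cong₂ ℤ._+_ difference (trans (cong (λ z → ℤ.+ (suffixSum e z)) (sym s+1)) (suffixSum-target k (ℕP.<-trans (ℕP.n<1+n k) lt))) ⟩
      (d (suc k) ℤ.- d k) ℤ.+ (ℤ.+ (β ℕ.* q) ℤ.+ d k)
        ≡⟨ solve 3 (λ a b c → (a :- b) :+ (c :+ b) := c :+ a) refl (d (suc k)) (d k) (ℤ.+ (β ℕ.* q)) ⟩
      ℤ.+ (β ℕ.* q) ℤ.+ d (suc k)                   ∎
      where
      open ≡-Reasoning
      s = ℓ ∸ suc (suc k)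
      s+1 : ℓ ∸ suc k ≡ suc s
      s+1 = ℕP.+-∸-assoc 1 lt
      s+1<ℓ : suc s ℕ.< ℓ
      s+1<ℓ = subst (ℕ._< ℓ) s+1 (ℕP.∸-monoʳ-< (s≤s z≤n) (ℕP.<⇒≤ lt))
      index1 : ℓ ∸ suc s ≡ suc k
      index1 = trans (cong (ℓ ∸_) (sym s+1)) (ℕP.m∸[m∸n]≡n (ℕP.<⇒≤ lt))
      index2 : ℓ ∸ suc (suc s) ≡ k
      index2 = trans (cong (λ z → ℓ ∸ suc z) (sym s+1))
        (trans (cong (ℓ ∸_) (sym (ℕP.+-∸-assoc 1 (ℕP.<-trans (ℕP.n<1+n k) lt)))) (ℕP.m∸[m∸n]≡n (ℕP.<⇒≤ (ℕP.<-trans (ℕP.n<1+n k) lt))))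
      difference : ℤ.+ (e s) ≡ d (suc k) ℤ.- d k
      difference = trans (cong (λ b → ℤ.+ (if b then ℤ.∣ d (ℓ ∸ suc s) ℤ.- d (ℓ ∸ suc (suc s)) ∣ else ℤ.∣ ℤ.+ (β ℕ.* q) ℤ.+ d 0 ∣)) (<ᵇ-true s+1<ℓ))
        (trans (cong₂ (λ a b → ℤ.+ ℤ.∣ d a ℤ.- d b ∣) index1 index2) (ℤP.0≤i⇒+∣i∣≡i (ℤP.i≤j⇒0≤j-i (mono k lt))))

module Automata where

  open import Defs
  open import Data.Bool using (Bool; true; false; if_then_else_; _∨_)
  open import Data.Nat as ℕ using (ℕ; zero; suc; _+_; _*_; z≤n; s≤s; _<ᵇ_; _≡ᵇ_)
  import Data.Nat.Properties as ℕP
  open import Data.Fin as Fin using (Fin; toℕ; fromℕ<)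
  import Data.Fin.Properties as FinP
  open import Data.List using (List; []; _∷_; length; replicate; _++_; foldl; drop)
  import Data.List.Properties as LP
  open import Data.List.Membership.Propositional using (_∈_)
  open import Data.List.Relation.Unary.Any using (here; there)
  open import Data.Maybe using (Maybe; just; nothing)
  open import Data.Product using (Σ; _×_; _,_; proj₁; proj₂)
  open import Data.Sum using (_⊎_; inj₁; inj₂)
  open import Data.Empty using (⊥-elim)
  open import Relation.Binary.PropositionalEquality
  open import Relation.Nullary using (yes; no; does)
  open Booleans

  small-multiple : ∀ β j k → j ℕ.< β → j ≡ β * k → j ≡ 0
  small-multiple β j zero    lt e = trans e (ℕP.*-zeroʳ β)
  small-multiple β j (suc k) lt e = ⊥-elim (ℕP.<⇒≱ lt (subst (β ℕ.≤_) (sym (trans e (ℕP.*-suc β k))) (ℕP.m≤m+n β (β * k))))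

  multiple-minus : ∀ β m k → 0 ℕ.< β → β + m ≡ β * k → m ≡ β * ℕ.pred k
  multiple-minus β m zero    pos e = ⊥-elim (ℕP.<⇒≢ (ℕP.≤-trans pos (ℕP.m≤m+n β m)) (sym (trans e (ℕP.*-zeroʳ β))))
  multiple-minus β m (suc k) pos e = ℕP.+-cancelˡ-≡ β m (β * k) (trans e (ℕP.*-suc β k))

  ∨-true⁻ : ∀ a b → (a ∨ b) ≡ true → (a ≡ true) ⊎ (b ≡ true)
  ∨-true⁻ true  b _ = inj₁ refl
  ∨-true⁻ false b e = inj₂ e

  ∨-trueʳ : ∀ a → (a ∨ true) ≡ true
  ∨-trueʳ true  = refl
  ∨-trueʳ false = refl

  true≢false : ∀ {A : Set} → true ≡ false → A
  true≢false ()

  zero-or-positive : ∀ b → (b ≡ 0) ⊎ (0 ℕ.< b)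
  zero-or-positive zero    = inj₁ refl
  zero-or-positive (suc b) = inj₂ (s≤s z≤n)

  module _ {ℓ : ℕ} where

    record Machine : Set where
      field
        size   : ℕ
        start  : ℕ
        step   : ℕ → Fin ℓ → ℕ
        final  : ℕ → Bool
        start< : start ℕ.< size
        step<  : ∀ s a → step s a ℕ.< size

    toDFA : Machine → DFA ℓ
    toDFA M = record { states = size ; start = fromℕ< start< ; δ = λ i a → fromℕ< (step< (toℕ i) a) ; accept = λ i → final (toℕ i) }
      where open Machine M

    accepts-toDFA : ∀ M w → accepts (toDFA M) w ≡ Machine.final M (foldl (Machine.step M) (Machine.start M) w)
    accepts-toDFA M w = cong (Machine.final M)
      (trans (run (fromℕ< (Machine.start< M)) w) (cong (λ z → foldl (Machine.step M) z w) (FinP.toℕ-fromℕ< (Machine.start< M))))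
      where
      run : ∀ i w → toℕ (foldl (DFA.δ (toDFA M)) i w) ≡ foldl (Machine.step M) (toℕ i) w
      run i []      = refl
      run i (a ∷ w) = trans (run _ w) (cong (λ z → foldl (Machine.step M) z w) (FinP.toℕ-fromℕ< (Machine.step< M (toℕ i) a)))

    union : DFA ℓ → DFA ℓ → DFA ℓ
    union A B = record
      { states = DFA.states A * DFA.states B
      ; start  = Fin.combine (DFA.start A) (DFA.start B)
      ; δ      = λ s a → Fin.combine (DFA.δ A (left s) a) (DFA.δ B (right s) a)
      ; accept = λ s → DFA.accept A (left s) ∨ DFA.accept B (right s) }
      where
      left  = λ s → proj₁ (Fin.remQuot {DFA.states A} (DFA.states B) s)
      right = λ s → proj₂ (Fin.remQuot {DFA.states A} (DFA.states B) s)

    accepts-union : ∀ A B w → accepts (union A B) w ≡ accepts A w ∨ accepts B w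
    accepts-union A B w = trans (cong (DFA.accept (union A B)) (run (DFA.start A) (DFA.start B) w))
      (cong (λ p → DFA.accept A (proj₁ p) ∨ DFA.accept B (proj₂ p))
        (FinP.remQuot-combine {n = DFA.states A} {k = DFA.states B} (foldl (DFA.δ A) (DFA.start A) w) (foldl (DFA.δ B) (DFA.start B) w)))
      where
      run : ∀ i j w → foldl (DFA.δ (union A B)) (Fin.combine i j) w ≡ Fin.combine (foldl (DFA.δ A) i w) (foldl (DFA.δ B) j w)
      run i j []      = refl
      run i j (a ∷ w) = trans
        (cong (λ s → foldl (DFA.δ (union A B)) s w)
          (cong (λ p → Fin.combine (DFA.δ A (proj₁ p) a) (DFA.δ B (proj₂ p) a)) (FinP.remQuot-combine {n = DFA.states A} {k = DFA.states B} i j)))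
        (run (DFA.δ A i a) (DFA.δ B j a) w)

    drop-nth : ∀ (xs : List (Fin ℓ)) i → i ℕ.< length xs → Σ (Fin ℓ) λ b → (nth xs i ≡ just b) × (drop i xs ≡ b ∷ drop (suc i) xs)
    drop-nth (y ∷ ys) zero    _       = y , refl , refl
    drop-nth (y ∷ ys) (suc i) (s≤s p) = drop-nth ys i p

    drop-length : ∀ (xs : List (Fin ℓ)) → drop (length xs) xs ≡ []
    drop-length []       = refl
    drop-length (y ∷ ys) = drop-length ys

    matches : Maybe (Fin ℓ) → Fin ℓ → Bool
    matches nothing  a = false
    matches (just b) a = does (b Fin.≟ a)

    matches-refl : ∀ b → matches (just b) b ≡ true
    matches-refl b with b Fin.≟ b
    ... | yes _  = refl
    ... | no b≢b = ⊥-elim (b≢b refl)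

    -- The lasso automaton for {v x^{βk} : k ≥ 0}: states 0..n-1 read v (n = |v|), states n..n+β-1
    -- form a cycle on x accepting at n, and n+β+1 is a dead state.
    module Lasso (v : List (Fin ℓ)) (x : Fin ℓ) (β : ℕ) where
      n    = length v
      dead = suc (n + β)

      step : ℕ → Fin ℓ → ℕ
      step s a = if s <ᵇ n then (if matches (nth v s) a then suc s else dead)
                 else (if s <ᵇ n + β then (if does (a Fin.≟ x) then (if suc s <ᵇ n + β then suc s else n) else dead) else dead)

      final : ℕ → Bool
      final s = s ≡ᵇ n

      step≤dead : ∀ s a → step s a ℕ.≤ dead
      step≤dead s a with s <ᵇ n in e1
      ... | true with matches (nth v s) a
      ...   | true  = ℕP.≤-trans (<ᵇ⇒< e1) (ℕP.≤-trans (ℕP.m≤m+n n β) (ℕP.n≤1+n _))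
      ...   | false = ℕP.≤-refl
      step≤dead s a | false with s <ᵇ n + β
      ...   | false = ℕP.≤-refl
      ...   | true with does (a Fin.≟ x)
      ...     | false = ℕP.≤-refl
      ...     | true with suc s <ᵇ n + β in e3
      ...       | true  = ℕP.≤-trans (ℕP.<⇒≤ (<ᵇ⇒< e3)) (ℕP.n≤1+n _)
      ...       | false = ℕP.≤-trans (ℕP.m≤m+n n β) (ℕP.n≤1+n _)

      machine : Machine
      machine = record { size = suc dead ; start = 0 ; step = step ; final = final ; start< = s≤s z≤n ; step< = λ s a → s≤s (step≤dead s a) }

      D : DFA ℓ
      D = toDFA machine

      dead-forever : ∀ w → foldl step dead w ≡ dead
      dead-forever []      = refl
      dead-forever (a ∷ w) rewrite <ᵇ-false {dead} {n} (ℕP.≤-trans (ℕP.m≤m+n n β) (ℕP.n≤1+n _))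
                                 | <ᵇ-false {dead} {n + β} (ℕP.n≤1+n _) = dead-forever w

      dead-rejects : ∀ w → final (foldl step dead w) ≡ false
      dead-rejects w rewrite dead-forever w = ≡ᵇ-≢ (λ e → ℕP.<⇒≢ (s≤s (ℕP.m≤m+n n β)) (sym e))

      prefix-run : ∀ k i w' → i + k ≡ n → foldl step i (drop i v ++ w') ≡ foldl step n w'
      prefix-run zero    i w' e rewrite ℕP.+-identityʳ i | e | drop-length v = refl
      prefix-run (suc k) i w' e = continue (subst (i ℕ.<_) e (ℕP.m<m+n i (s≤s z≤n)))
        where
        continue : i ℕ.< n → foldl step i (drop i v ++ w') ≡ foldl step n w'
        continue i<n with drop-nth v i i<n
        ... | b , e1 , e2 rewrite e2 | <ᵇ-true i<n | e1 | matches-refl b = prefix-run k (suc i) w' (trans (sym (ℕP.+-suc i k)) e)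

      prefix-accepted : ∀ i w → i ℕ.≤ n → final (foldl step i w) ≡ true →
        Σ (List (Fin ℓ)) λ w' → (w ≡ drop i v ++ w') × (final (foldl step n w') ≡ true)
      prefix-accepted i w le e with ℕP.m≤n⇒m<n∨m≡n le
      ... | inj₂ refl = w , cong (_++ w) (sym (drop-length v)) , e
      prefix-accepted i []      le e | inj₁ lt = ⊥-elim (ℕP.<⇒≢ lt (≡ᵇ⇒≡ e))
      prefix-accepted i (a ∷ w) le e | inj₁ lt with drop-nth v i lt
      ... | b , e1 , e2 rewrite <ᵇ-true lt | e1 with b Fin.≟ a
      ...   | no _     = true≢false (trans (sym e) (dead-rejects w))
      ...   | yes refl with prefix-accepted (suc i) w lt e
      ...     | w' , ew , ea = w' , trans (cong (b ∷_) ew) (cong (_++ w') (sym e2)) , ea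

      cycle-step : ∀ j a → j ℕ.< β → step (n + j) a ≡ (if does (a Fin.≟ x) then (if suc (n + j) <ᵇ n + β then suc (n + j) else n) else dead)
      cycle-step j a lt rewrite <ᵇ-false {n + j} {n} (ℕP.m≤m+n n j) | <ᵇ-true (ℕP.+-monoʳ-< n lt) = refl

      n+0 : n + 0 ≡ n
      n+0 = ℕP.+-identityʳ n

      cycle-accepted : ∀ j w → j ℕ.< β → final (foldl step (n + j) w) ≡ true →
        Σ ℕ λ k → (j + length w ≡ β * k) × (w ≡ replicate (length w) x)
      cycle-accepted j [] lt e =
        0 , trans (ℕP.+-identityʳ j) (trans (ℕP.+-cancelˡ-≡ n j 0 (trans (≡ᵇ⇒≡ e) (sym n+0))) (sym (ℕP.*-zeroʳ β))) , refl
      cycle-accepted j (a ∷ w) lt e rewrite cycle-step j a lt with a Fin.≟ x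
      ... | no _ = true≢false (trans (sym e) (dead-rejects w))
      ... | yes refl with suc j ℕP.<? β
      ...   | yes j+1<β rewrite <ᵇ-true (subst (ℕ._< n + β) (ℕP.+-suc n j) (ℕP.+-monoʳ-< n j+1<β))
               with cycle-accepted (suc j) w j+1<β (subst (λ z → final (foldl step z w) ≡ true) (sym (ℕP.+-suc n j)) e)
      ...     | k , ek , ew = k , trans (ℕP.+-suc j (length w)) ek , cong (a ∷_) ew
      cycle-accepted j (a ∷ w) lt e | yes refl | no j+1≮β
        rewrite <ᵇ-false {suc (n + j)} {n + β} (subst (n + β ℕ.≤_) (ℕP.+-suc n j) (ℕP.+-monoʳ-≤ n (ℕP.≮⇒≥ j+1≮β)))
        with cycle-accepted 0 w (ℕP.≤-trans (s≤s z≤n) lt) (subst (λ z → final (foldl step z w) ≡ true) (sym n+0) e)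
      ... | k , ek , ew = suc k , length-eq , cong (a ∷_) ew
        where
        j+1≡β : suc j ≡ β
        j+1≡β = ℕP.≤-antisym lt (ℕP.≮⇒≥ j+1≮β)
        length-eq : j + suc (length w) ≡ β * suc k
        length-eq = trans (ℕP.+-suc j (length w)) (trans (cong (_+ length w) j+1≡β) (trans (cong (β +_) ek) (sym (ℕP.*-suc β k))))

      cycle-accepts : ∀ j m k → j ℕ.< β → j + m ≡ β * k → final (foldl step (n + j) (replicate m x)) ≡ true
      cycle-accepts j zero k lt e =
        subst (λ z → final z ≡ true) (sym (cong (n +_) (small-multiple β j k lt (trans (sym (ℕP.+-identityʳ j)) e))))
              (trans (cong final n+0) (≡ᵇ-refl n))
      cycle-accepts j (suc m) k lt e rewrite cycle-step j x lt with x Fin.≟ x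
      ... | no x≢x = ⊥-elim (x≢x refl)
      ... | yes _ with suc j ℕP.<? β
      ...   | yes j+1<β rewrite <ᵇ-true (subst (ℕ._< n + β) (ℕP.+-suc n j) (ℕP.+-monoʳ-< n j+1<β)) =
                subst (λ z → final (foldl step z (replicate m x)) ≡ true) (ℕP.+-suc n j)
                      (cycle-accepts (suc j) m k j+1<β (trans (sym (ℕP.+-suc j m)) e))
      cycle-accepts j (suc m) k lt e | yes _ | no j+1≮β
        rewrite <ᵇ-false {suc (n + j)} {n + β} (subst (n + β ℕ.≤_) (ℕP.+-suc n j) (ℕP.+-monoʳ-≤ n (ℕP.≮⇒≥ j+1≮β))) =
        subst (λ z → final (foldl step z (replicate m x)) ≡ true) n+0
          (cycle-accepts 0 m (ℕ.pred k) (ℕP.≤-trans (s≤s z≤n) lt) (multiple-minus β m k (ℕP.≤-trans (s≤s z≤n) lt) β+m≡βk))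
        where
        β+m≡βk : β + m ≡ β * k
        β+m≡βk = trans (cong (_+ m) (sym (ℕP.≤-antisym lt (ℕP.≮⇒≥ j+1≮β)))) (trans (sym (ℕP.+-suc j m)) e)

      loop-accepted : ∀ w → final (foldl step n w) ≡ true → Σ ℕ λ k → w ≡ replicate (β * k) x
      loop-accepted []      e = 0 , cong (λ z → replicate z x) (sym (ℕP.*-zeroʳ β))
      loop-accepted (a ∷ w) e with zero-or-positive β
      ... | inj₁ β≡0 = true≢false (trans (sym e) (trans (cong (λ z → final (foldl step z w)) stuck) (dead-rejects w)))
        where
        stuck : step n a ≡ dead
        stuck rewrite <ᵇ-false {n} {n} ℕP.≤-refl | <ᵇ-false {n} {n + β} (ℕP.≤-reflexive (trans (cong (n +_) β≡0) n+0)) = refl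
      ... | inj₂ β>0 with cycle-accepted 0 (a ∷ w) β>0 (subst (λ z → final (foldl step z (a ∷ w)) ≡ true) (sym n+0) e)
      ...   | k , ek , ew = k , trans ew (cong (λ z → replicate z x) ek)

      loop-accepts : ∀ k → final (foldl step n (replicate (β * k) x)) ≡ true
      loop-accepts k with zero-or-positive β
      ... | inj₁ β≡0 = subst (λ z → final (foldl step n (replicate z x)) ≡ true) (sym (cong (_* k) β≡0)) (≡ᵇ-refl n)
      ... | inj₂ β>0 = subst (λ z → final (foldl step z (replicate (β * k) x)) ≡ true) n+0 (cycle-accepts 0 (β * k) k β>0 refl)

      lasso-sound : ∀ w → accepts D w ≡ true → Σ ℕ λ k → w ≡ v ++ replicate (β * k) x
      lasso-sound w e with prefix-accepted 0 w z≤n (trans (sym (accepts-toDFA machine w)) e)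
      ... | w' , ew , ea with loop-accepted w' ea
      ...   | k , ek = k , trans ew (cong (v ++_) ek)

      lasso-complete : ∀ k → accepts D (v ++ replicate (β * k) x) ≡ true
      lasso-complete k = trans (accepts-toDFA machine (v ++ replicate (β * k) x))
        (trans (cong final (prefix-run n 0 (replicate (β * k) x) refl)) (loop-accepts k))

    -- A finite list of words, as a union of lassos of period 0.
    finiteDFA : Fin ℓ → List (List (Fin ℓ)) → DFA ℓ
    finiteDFA x []       = record { states = 1 ; start = Fin.zero ; δ = λ s a → s ; accept = λ _ → false }
    finiteDFA x (u ∷ us) = union (Lasso.D u x 0) (finiteDFA x us)

    finite-sound : ∀ x us w → accepts (finiteDFA x us) w ≡ true → w ∈ us
    finite-sound x (u ∷ us) w e with ∨-true⁻ _ _ (trans (sym (accepts-union (Lasso.D u x 0) (finiteDFA x us) w)) e)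
    ... | inj₁ e1 with Lasso.lasso-sound u x 0 w e1
    ...   | k , ew = here (trans ew (LP.++-identityʳ u))
    finite-sound x (u ∷ us) w e | inj₂ e2 = there (finite-sound x us w e2)

    finite-complete : ∀ x us w → w ∈ us → accepts (finiteDFA x us) w ≡ true
    finite-complete x (u ∷ us) .u (here refl) = trans (accepts-union (Lasso.D u x 0) (finiteDFA x us) u)
      (cong (_∨ accepts (finiteDFA x us) u) (subst (λ z → accepts (Lasso.D u x 0) z ≡ true) (LP.++-identityʳ u) (Lasso.lasso-complete u x 0 0)))
    finite-complete x (u ∷ us) w (there p) = trans (accepts-union (Lasso.D u x 0) (finiteDFA x us) w)
      (trans (cong (accepts (Lasso.D u x 0) w ∨_) (finite-complete x us w p)) (∨-trueʳ _))

open import Data.Bool using (true; if_then_else_; _∨_)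
open import Data.Nat using (zero; z≤n; s≤s; _<ᵇ_)
import Data.Nat.Properties as ℕP
open import Data.Fin as Fin using (Fin; toℕ)
import Data.Fin.Properties as FinP
open import Data.List using ([]; _∷_; _++_; tabulate; concatMap)
import Data.List.Properties as LP
open import Data.List.Membership.Propositional using (_∈_)
open import Data.List.Membership.Propositional.Properties using (∈-++⁺ˡ; ∈-++⁺ʳ; ∈-++⁻)
open import Data.List.Relation.Unary.Any using (here)
open import Data.Maybe using (Maybe; nothing)
import Data.Integer.Properties as ℤP
open import Data.Integer.Solver using (module +-*-Solver)
open import Data.Product using (_,_)
open import Data.Sum using (_⊎_; inj₁; inj₂)
open import Relation.Binary.PropositionalEquality using (refl; sym; trans; cong; cong₂; subst; module ≡-Reasoning)
open import Relation.Nullary using (yes; no)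
open Booleans
open Rationals
open FiniteSums
open ℚΣ
open PolynomialIdentity
open CoefficientTable
open Ranking
open WordCounts
open Valuation
open TargetWords
open Automata

polynomial-identity : (ℓ β : ℕ) → 1 ℕ.≤ ℓ → (q : ℚ) →
  powQ (ℕtoℚ β) ℓ ℚ.* Σ[ 0 to ℓ ∸ 1 ] (λ k → binomQ (q ℚ.+ ℕtoℚ k) (suc k))
    ≡ Σ[ 0 to ℓ ∸ 1 ] (λ k → binomQ (ℕtoℚ β ℚ.* q ℚ.+ c ℓ β k ℚ.+ ℕtoℚ k) (suc k))
polynomial-identity (suc L) β _ q = begin
  powQ (ℕtoℚ β) (suc L) ℚ.* Σ[ 0 to L ] (λ k → binomQ (q ℚ.+ ℕtoℚ k) (suc k))
    ≡⟨ cong (powQ (ℕtoℚ β) (suc L) ℚ.*_) (Σ-to 0 L (λ k → binomQ (q ℚ.+ ℕtoℚ k) (suc k))) ⟩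
  powQ (ℕtoℚ β) (suc L) ℚ.* sumN (suc L) (λ k → binomQ (q ℚ.+ ℕtoℚ k) (suc k))
    ≡⟨ CoefficientComparison.identity L β (c (suc L) β) (c-recursion (suc L) β) q ⟩
  sumN (suc L) (λ k → binomQ (ℕtoℚ β ℚ.* q ℚ.+ c (suc L) β k ℚ.+ ℕtoℚ k) (suc k))
    ≡⟨ sym (Σ-to 0 L (λ k → binomQ (ℕtoℚ β ℚ.* q ℚ.+ c (suc L) β k ℚ.+ ℕtoℚ k) (suc k))) ⟩
  Σ[ 0 to L ] (λ k → binomQ (ℕtoℚ β ℚ.* q ℚ.+ c (suc L) β k ℚ.+ ℕtoℚ k) (suc k)) ∎
  where open ≡-Reasoning

module Image (L β : ℕ) (hℓ : 1 ℕ.≤ suc L) (d : ℕ → ℤ)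
   (hc : (k : ℕ) → k ℕ.< suc L → c (suc L) β k ≡ ℤtoℚ (d k))
   (mono : (k : ℕ) → suc k ℕ.< suc L → d k ℤ.≤ d (suc k)) where
  ℓ = suc L
  open Alphabet ℓ
  open Counting ℓ
  open Numeration ℓ
  open PowWords ℓ

  x : Fin ℓ
  x = aTop ℓ hℓ

  power : ℕ → W
  power q = replicate q x

  nondec-power : ∀ q → nondecᵇ 0 (power q) ≡ true
  nondec-power q = nondec-replicate 0 x q z≤n

  target : ℕ → W
  target q = powWord ℓ (targetExp ℓ β d q)

  -- a_ℓ^q has q letters ≥ a_{ℓ-k} for every k.
  val-power : ∀ q → ℕtoℚ (val (power q)) ≡ sumN ℓ (λ k → binomQ (ℕtoℚ q ℚ.+ ℕtoℚ k) (suc k))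
  val-power q = trans (val-binomial (power q) (nondec-power q))
    (sumN-cong ℓ (λ k _ → cong (λ z → binomQ z (suc k)) (trans (cong (λ z → ℕtoℚ (z ℕ.+ k)) (all-top k)) (ℕtoℚ-+ q k))))
    where
    all-top : ∀ k → letters≥ (ℓ ∸ suc k) (power q) ≡ q
    all-top k = trans (letters≥-replicate (ℓ ∸ suc k) q x)
      (cong (λ b → if b then q else 0) (≤ᵇ-true (subst (ℓ ∸ suc k ℕ.≤_) (sym (FinP.toℕ-fromℕ L)) (ℕP.m∸n≤m L k))))

  module _ (q : ℕ) (nonneg : ℤ.0ℤ ℤ.≤ ℤ.+ (β ℕ.* q) ℤ.+ d 0) where
    open Target L β d q nonneg mono using (suffixSum-target; e)

    -- The target word has βq + c_k letters ≥ a_{ℓ-k}.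
    val-target : ℕtoℚ (val (target q)) ≡ sumN ℓ (λ k → binomQ (ℕtoℚ β ℚ.* ℕtoℚ q ℚ.+ c ℓ β k ℚ.+ ℕtoℚ k) (suc k))
    val-target = trans (val-binomial (target q) (nondec-powWord (targetExp ℓ β d q)))
      (sumN-cong ℓ (λ k p → cong (λ z → binomQ z (suc k)) (letters k p)))
      where
      letters : ∀ k → k ℕ.< ℓ → ℕtoℚ (letters≥ (ℓ ∸ suc k) (target q) ℕ.+ k) ≡ ℕtoℚ β ℚ.* ℕtoℚ q ℚ.+ c ℓ β k ℚ.+ ℕtoℚ k
      letters k p = begin
        ℕtoℚ (letters≥ (ℓ ∸ suc k) (target q) ℕ.+ k)
          ≡⟨ cong (λ z → ℕtoℚ (z ℕ.+ k)) (letters≥-powWord (ℓ ∸ suc k) (targetExp ℓ β d q) e (λ _ → refl)) ⟩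
        ℕtoℚ (suffixSum e (ℓ ∸ suc k) ℕ.+ k)                  ≡⟨ ℕtoℚ-+ (suffixSum e (ℓ ∸ suc k)) k ⟩
        ℤtoℚ (ℤ.+ suffixSum e (ℓ ∸ suc k)) ℚ.+ ℕtoℚ k          ≡⟨ cong (λ z → ℤtoℚ z ℚ.+ ℕtoℚ k) (suffixSum-target k p) ⟩
        ℤtoℚ (ℤ.+ (β ℕ.* q) ℤ.+ d k) ℚ.+ ℕtoℚ k               ≡⟨ cong (ℚ._+ ℕtoℚ k) (ℤtoℚ-+ (ℤ.+ (β ℕ.* q)) (d k)) ⟩
        ℕtoℚ (β ℕ.* q) ℚ.+ ℤtoℚ (d k) ℚ.+ ℕtoℚ k              ≡⟨ cong₂ (λ u v → u ℚ.+ v ℚ.+ ℕtoℚ k) (ℕtoℚ-* β q) (sym (hc k p)) ⟩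
        ℕtoℚ β ℚ.* ℕtoℚ q ℚ.+ c ℓ β k ℚ.+ ℕtoℚ k ∎
        where open ≡-Reasoning

    -- By part 1 at the rational point q, both sides agree after casting to ℚ.
    val-scaled : β ℕ.^ ℓ ℕ.* val (power q) ≡ val (target q)
    val-scaled = ℕtoℚ-injective _ _ (begin
      ℕtoℚ (β ℕ.^ ℓ ℕ.* val (power q))                 ≡⟨ ℕtoℚ-* (β ℕ.^ ℓ) (val (power q)) ⟩
      ℕtoℚ (β ℕ.^ ℓ) ℚ.* ℕtoℚ (val (power q))          ≡⟨ cong₂ ℚ._*_ (ℕtoℚ-^ β ℓ) (val-power q) ⟩
      powQ (ℕtoℚ β) ℓ ℚ.* sumN ℓ (λ k → binomQ (ℕtoℚ q ℚ.+ ℕtoℚ k) (suc k))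
        ≡⟨ CoefficientComparison.identity L β (c ℓ β) (c-recursion ℓ β) (ℕtoℚ q) ⟩
      sumN ℓ (λ k → binomQ (ℕtoℚ β ℚ.* ℕtoℚ q ℚ.+ c ℓ β k ℚ.+ ℕtoℚ k) (suc k)) ≡⟨ sym val-target ⟩
      ℕtoℚ (val (target q)) ∎)
      where open ≡-Reasoning

    rep-scaled : (N : ℕ) → rep ℓ N ≡ just (power q) → rep ℓ (β ℕ.^ ℓ ℕ.* N) ≡ just (target q)
    rep-scaled N e = trans (cong (λ z → rep ℓ (β ℕ.^ ℓ ℕ.* z)) (val-rep N (power q) e))
                      (trans (cong (rep ℓ) val-scaled) (rep-val hℓ (target q) (nondec-powWord (targetExp ℓ β d q))))

replicate-+ : ∀ {A : Set} m n (a : A) → replicate (m ℕ.+ n) a ≡ replicate m a ++ replicate n a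
replicate-+ zero    n a = refl
replicate-+ (suc m) n a = cong (a ∷_) (replicate-+ m n a)

module LastBlock (L : ℕ) where
  last : Fin (suc L)
  last = Fin.fromℕ L

  initialBlocks : (Fin (suc L) → ℕ) → Word (suc L)
  initialBlocks e = concatMap (λ t → replicate (e t) t) (tabulate (Fin.inject₁ {L}))

  powWord-last : ∀ e → powWord (suc L) e ≡ initialBlocks e ++ replicate (e last) last
  powWord-last e = trans (cong (concatMap block) (tabulate-snoc L (λ i → i)))
    (trans (concatMap-++ (tabulate (Fin.inject₁ {L})) (last ∷ [])) (cong (initialBlocks e ++_) (LP.++-identityʳ _)))
    where
    block = λ t → replicate (e t) t
    tabulate-snoc : ∀ n {A : Set} (g : Fin (suc n) → A) → tabulate g ≡ tabulate (λ i → g (Fin.inject₁ i)) ++ (g (Fin.fromℕ n) ∷ [])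
    tabulate-snoc zero    g = refl
    tabulate-snoc (suc n) g = cong (g Fin.zero ∷_) (tabulate-snoc n (λ i → g (Fin.suc i)))
    concatMap-++ : ∀ xs ys → concatMap block (xs ++ ys) ≡ concatMap block xs ++ concatMap block ys
    concatMap-++ []       ys = refl
    concatMap-++ (t ∷ xs) ys = trans (cong (block t ++_) (concatMap-++ xs ys)) (sym (LP.++-assoc (block t) _ _))

  initialBlocks-cong : ∀ e e' → (∀ i → e (Fin.inject₁ i) ≡ e' (Fin.inject₁ i)) → initialBlocks e ≡ initialBlocks e'
  initialBlocks-cong e e' agree = go L (Fin.inject₁ {L}) (λ i → agree i)
    where
    go : ∀ n (g : Fin n → Fin (suc L)) → (∀ i → e (g i) ≡ e' (g i)) →
      concatMap (λ t → replicate (e t) t) (tabulate g) ≡ concatMap (λ t → replicate (e' t) t) (tabulate g)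
    go zero    g h = refl
    go (suc n) g h = cong₂ _++_ (cong (λ z → replicate z (g Fin.zero)) (h Fin.zero)) (go n (λ i → g (Fin.suc i)) (λ i → h (Fin.suc i)))

-- Part 3: the image language is the finite set of images of q < |d_0| together with
-- the lasso { target(q₀) a_ℓ^{βk} : k ≥ 0 },  q₀ = |d_0|.
module Regularity (L β : ℕ) (hℓ : 1 ℕ.≤ suc L) (hβ : 1 ℕ.≤ β) (d : ℕ → ℤ)
   (hc : (k : ℕ) → k ℕ.< suc L → c (suc L) β k ≡ ℤtoℚ (d k))
   (mono : (k : ℕ) → suc k ℕ.< suc L → d k ℤ.≤ d (suc k)) where
  open Image L β hℓ d hc mono
  open Alphabet ℓ
  open Numeration ℓ
  open LastBlock L

  q₀ = ℤ.∣ d 0 ∣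

  nonneg : ∀ q → q₀ ℕ.≤ q → ℤ.0ℤ ℤ.≤ ℤ.+ (β ℕ.* q) ℤ.+ d 0
  nonneg q le with d 0
  ... | ℤ.+ n    = ℤ.+≤+ z≤n
  ... | ℤ.-[1+ n ] = subst (ℤ.0ℤ ℤ.≤_) (sym (ℤP.⊖-≥ βq≥n+1)) (ℤ.+≤+ z≤n)
    where
    βq≥n+1 : suc n ℕ.≤ β ℕ.* q
    βq≥n+1 = ℕP.≤-trans le (subst (ℕ._≤ β ℕ.* q) (ℕP.*-identityˡ q) (ℕP.*-monoˡ-≤ q hβ))

  Lang : W → Set
  Lang w = Σ ℕ λ q → Σ ℕ λ N → (rep ℓ N ≡ just (replicate q (aTop ℓ hℓ))) × (rep ℓ (β ℕ.^ ℓ ℕ.* N) ≡ just w)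

  image : ℕ → Maybe W
  image q = rep ℓ (β ℕ.^ ℓ ℕ.* val (power q))

  images : ℕ → List W
  images zero    = []
  images (suc m) = images m ++ toList (image m)
    where
    toList : Maybe W → List W
    toList nothing  = []
    toList (just w) = w ∷ []

  images-complete : ∀ m q w → q ℕ.< m → image q ≡ just w → w ∈ images m
  images-complete (suc m) q w lt e with ℕP.m≤n⇒m<n∨m≡n (ℕP.≤-pred lt)
  ... | inj₁ lt'  = ∈-++⁺ˡ (images-complete m q w lt' e)
  ... | inj₂ refl rewrite e = ∈-++⁺ʳ (images m) (here refl)

  images-sound : ∀ m w → w ∈ images m → Σ ℕ λ q → (q ℕ.< m) × (image q ≡ just w)
  images-sound (suc m) w p with ∈-++⁻ (images m) p
  ... | inj₁ p' with images-sound m w p'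
  ...   | q , lt , e = q , ℕP.<-trans lt (ℕP.n<1+n m) , e
  images-sound (suc m) w p | inj₂ p' with image m in eq
  images-sound (suc m) w p | inj₂ (here refl) | just w' = m , ℕP.n<1+n m , eq

  -- The exponents of the target word: those of a_1 ... a_{ℓ-1} do not depend on q, that of a_ℓ is βq + d_0.
  middleExp : Fin L → ℕ
  middleExp i = ℤ.∣ d (ℓ ∸ suc (toℕ (Fin.inject₁ i))) ℤ.- d (ℓ ∸ suc (suc (toℕ (Fin.inject₁ i)))) ∣

  lastExp : ℕ → ℕ
  lastExp q = ℤ.∣ ℤ.+ (β ℕ.* q) ℤ.+ d 0 ∣

  targetExp-middle : ∀ q i → targetExp ℓ β d q (Fin.inject₁ i) ≡ middleExp i
  targetExp-middle q i = cong (λ b → if b then middleExp i else lastExp q)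
    (<ᵇ-true (s≤s (subst (ℕ._< L) (sym (FinP.toℕ-inject₁ i)) (FinP.toℕ<n i))))

  targetExp-last : ∀ q → targetExp ℓ β d q last ≡ lastExp q
  targetExp-last q = cong (λ b → if b then ℤ.∣ d (ℓ ∸ suc (toℕ last)) ℤ.- d (ℓ ∸ suc (suc (toℕ last))) ∣ else lastExp q)
    (trans (cong (λ z → suc z <ᵇ ℓ) (FinP.toℕ-fromℕ L)) (<ᵇ-false {ℓ} {ℓ} ℕP.≤-refl))

  lastExp-shift : ∀ k → lastExp (q₀ ℕ.+ k) ≡ lastExp q₀ ℕ.+ β ℕ.* k
  lastExp-shift k = trans (cong ℤ.∣_∣ regroup) (abs-+ _ (β ℕ.* k) (nonneg q₀ ℕP.≤-refl))
    where
    open +-*-Solver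
    regroup : ℤ.+ (β ℕ.* (q₀ ℕ.+ k)) ℤ.+ d 0 ≡ (ℤ.+ (β ℕ.* q₀) ℤ.+ d 0) ℤ.+ ℤ.+ (β ℕ.* k)
    regroup = trans (cong (λ z → ℤ.+ z ℤ.+ d 0) (ℕP.*-distribˡ-+ β q₀ k))
      (trans (cong (ℤ._+ d 0) (ℤP.pos-+ (β ℕ.* q₀) (β ℕ.* k)))
        (solve 3 (λ a b c → (a :+ b) :+ c := (a :+ c) :+ b) refl (ℤ.+ (β ℕ.* q₀)) (ℤ.+ (β ℕ.* k)) (d 0)))
    abs-+ : ∀ z m → ℤ.0ℤ ℤ.≤ z → ℤ.∣ z ℤ.+ ℤ.+ m ∣ ≡ ℤ.∣ z ∣ ℕ.+ m
    abs-+ (ℤ.+ n) m _ = refl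

  target-shift : ∀ k → target (q₀ ℕ.+ k) ≡ target q₀ ++ replicate (β ℕ.* k) x
  target-shift k = begin
    target (q₀ ℕ.+ k)                                                     ≡⟨ powWord-last (targetExp ℓ β d (q₀ ℕ.+ k)) ⟩
    initialBlocks (targetExp ℓ β d (q₀ ℕ.+ k)) ++ replicate (targetExp ℓ β d (q₀ ℕ.+ k) last) last
      ≡⟨ cong₂ (λ a n → a ++ replicate n last)
           (initialBlocks-cong _ _ (λ i → trans (targetExp-middle (q₀ ℕ.+ k) i) (sym (targetExp-middle q₀ i))))
           (trans (targetExp-last (q₀ ℕ.+ k)) (lastExp-shift k)) ⟩
    initialBlocks E₀ ++ replicate (lastExp q₀ ℕ.+ β ℕ.* k) last          ≡⟨ cong (initialBlocks E₀ ++_) (replicate-+ (lastExp q₀) (β ℕ.* k) last) ⟩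
    initialBlocks E₀ ++ (replicate (lastExp q₀) last ++ replicate (β ℕ.* k) last) ≡⟨ sym (LP.++-assoc (initialBlocks E₀) _ _) ⟩
    (initialBlocks E₀ ++ replicate (lastExp q₀) last) ++ replicate (β ℕ.* k) last
      ≡⟨ cong (λ z → (initialBlocks E₀ ++ replicate z last) ++ replicate (β ℕ.* k) last) (sym (targetExp-last q₀)) ⟩
    (initialBlocks E₀ ++ replicate (E₀ last) last) ++ replicate (β ℕ.* k) last ≡⟨ cong (_++ replicate (β ℕ.* k) x) (sym (powWord-last E₀)) ⟩
    target q₀ ++ replicate (β ℕ.* k) x ∎
    where
    open ≡-Reasoning
    E₀ = targetExp ℓ β d q₀

  Lang⇒ : ∀ w → Lang w → (w ∈ images q₀) ⊎ (Σ ℕ λ k → w ≡ target q₀ ++ replicate (β ℕ.* k) x)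
  Lang⇒ w (q , N , e1 , e2) with q ℕP.<? q₀
  ... | yes lt = inj₁ (images-complete q₀ q w lt (subst (λ z → rep ℓ (β ℕ.^ ℓ ℕ.* z) ≡ just w) (val-rep N (power q) e1) e2))
  ... | no ¬lt = inj₂ (q ∸ q₀ , trans (just-injective (trans (sym e2) (rep-scaled q (nonneg q q₀≤q) N e1)))
                                      (trans (cong target (sym (ℕP.m+[n∸m]≡n q₀≤q))) (target-shift (q ∸ q₀))))
    where
    q₀≤q = ℕP.≮⇒≥ ¬lt
    just-injective : ∀ {a b : W} → just a ≡ just b → a ≡ b
    just-injective refl = refl

  Lang⇐ : ∀ w → (w ∈ images q₀) ⊎ (Σ ℕ λ k → w ≡ target q₀ ++ replicate (β ℕ.* k) x) → Lang w
  Lang⇐ w (inj₁ p) with images-sound q₀ w p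
  ... | q , _ , e = q , val (power q) , rep-val hℓ (power q) (nondec-power q) , e
  Lang⇐ w (inj₂ (k , refl)) = q , val (power q) , rep-val hℓ (power q) (nondec-power q) ,
    trans (rep-scaled q (nonneg q (ℕP.m≤m+n q₀ k)) (val (power q)) (rep-val hℓ (power q) (nondec-power q)))
          (cong just (target-shift k))
    where q = q₀ ℕ.+ k

  finitePart lassoPart automaton : DFA ℓ
  finitePart = finiteDFA x (images q₀)
  lassoPart  = Lasso.D (target q₀) x β
  automaton  = union finitePart lassoPart

  regular : Regular ℓ Lang
  regular = automaton , λ w → sound w , complete w
    where
    sound : ∀ w → accepts automaton w ≡ true → Lang w
    sound w e with ∨-true⁻ (accepts finitePart w) (accepts lassoPart w) (trans (sym (accepts-union finitePart lassoPart w)) e)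
    ... | inj₁ a = Lang⇐ w (inj₁ (finite-sound x (images q₀) w a))
    ... | inj₂ a = Lang⇐ w (inj₂ (Lasso.lasso-sound (target q₀) x β w a))
    complete : ∀ w → Lang w → accepts automaton w ≡ true
    complete w l with Lang⇒ w l
    ... | inj₁ p = trans (accepts-union finitePart lassoPart w)
                         (cong (_∨ accepts lassoPart w) (finite-complete x (images q₀) w p))
    ... | inj₂ (k , refl) = trans (accepts-union finitePart lassoPart w)
                                  (trans (cong (accepts finitePart w ∨_) (Lasso.lasso-complete (target q₀) x β k)) (∨-trueʳ _))

lemma26 : (ℓ β : ℕ) → (hℓ : 1 ℕ.≤ ℓ) → 1 ℕ.≤ β →
    ((q : ℚ) →
      powQ (ℕtoℚ β) ℓ ℚ.* Σ[ 0 to ℓ ∸ 1 ] (λ k → binomQ (q ℚ.+ ℕtoℚ k) (suc k))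
        ≡ Σ[ 0 to ℓ ∸ 1 ] (λ k →
            binomQ (ℕtoℚ β ℚ.* q ℚ.+ c ℓ β k ℚ.+ ℕtoℚ k) (suc k)))
    ×
    ((d : ℕ → ℤ) →
      ((k : ℕ) → k ℕ.< ℓ → c ℓ β k ≡ ℤtoℚ (d k)) →
      ((k : ℕ) → suc k ℕ.< ℓ → d k ℤ.≤ d (suc k)) →
      ((q : ℕ) → ℤ.0ℤ ℤ.≤ ℤ.+ (β ℕ.* q) ℤ.+ d 0 →
        (N : ℕ) → rep ℓ N ≡ just (replicate q (aTop ℓ hℓ)) →
        rep ℓ (β ℕ.^ ℓ ℕ.* N) ≡ just (powWord ℓ (targetExp ℓ β d q)))
      ×
      Regular ℓ (λ w → Σ ℕ λ q → Σ ℕ λ N →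
        (rep ℓ N ≡ just (replicate q (aTop ℓ hℓ))) × (rep ℓ (β ℕ.^ ℓ ℕ.* N) ≡ just w)))
lemma26 (suc L) β hℓ hβ =
  polynomial-identity (suc L) β hℓ ,
  λ d hc mono → Image.rep-scaled L β hℓ d hc mono , Regularity.regular L β hℓ hβ d hc mono
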